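{- Let $n\geq 2$ and let $\mathrm{St}_n$ be the star graph on $n$ vertices with root $v_0$. Let $\alpha=(\alpha_1,\dots,\alpha_\ell)$ be a composition of $n$ and let $b_\alpha(q)$ be the coefficient of $M_\alpha$ in $T\mathrm{st}_n(q)$. Then $$b_\alpha(q)=\sum_{i:\ \alpha_i=1}\mathrm{mult}(\mathrm{rcomp}(\alpha,i))\,\mathrm{mult}(\mathrm{lcomp}(\alpha,i))\sum_{l=0}^{s_i}\binom{n}{l}q^l[n-2l]_q,\qquad s_i=\min\{R_{\alpha_i},L_{\alpha_i}\}.$$ Equivalently, for each $i$ with $\alpha_i=1$, writing $s=\min\{R_{\alpha_i},L_{\alpha_i}\}$ and $s_0=\min\{k,s\}$, $$[q^k]\,b_\alpha(i;q)=\mathrm{mult}(\mathrm{rcomp}(\alpha,i))\,\mathrm{mult}(\mathrm{lcomp}(\alpha,i))\sum_{l=0}^{s_0}\binom{n}{l}\qquad\text{for } 0\leq k\leq \left\lfloor\tfrac{n-1}{2}\right\rfloor.$$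
   Context: The star graph $\mathrm{St}_n$ has vertex set of size $n$, a distinguished vertex $v_0$ (the root), and edges exactly $\{v_0,v\}$ for all $v\neq v_0$. A labeling is a bijection $L:V\to\{1,\dots,n\}$; a proper coloring is a map $\kappa:V\to\mathbb{Z}_{>0}$ with adjacent vertices receiving different colors; $\mathrm{asc}^L(\kappa)$ is the number of edges $\{u,v\}$ with $L(u)<L(v)$ and $\kappa(u)<\kappa(v)$. The chromatic quasisymmetric function is $\chi^L_G(x;q)=\sum_{\kappa}q^{\mathrm{asc}^L(\kappa)}x^\kappa$ with $x^\kappa=\prod_j x_j^{\#\kappa^{ -1}(j)}$. For $1\le r\le n$ let $\mathrm{st}^r_n(q)=\chi^L_{\mathrm{St}_n}(x;q)$ for any labeling $L$ with $L(v_0)=r$ (this does not depend on the choice of such $L$), and $T\mathrm{st}_n(q)=\sum_{r=1}^n\mathrm{st}^r_n(q)$ (equal to $\frac{1}{(n-1)!}\sum_L\chi^L_{\mathrm{St}_n}(x;q)$). The monomial quasisymmetric function is $M_\alpha=\sum_{i_1<\dots<i_\ell}x_{i_1}^{\alpha_1}\cdots x_{i_\ell}^{\alpha_\ell}$. For a composition $\alpha$ of $n$ with $\ell$ parts and $i$ with $\alpha_i=1$, $b_\alpha(i;q)=\sum_{r=1}^n\sum_\kappa q^{\mathrm{asc}^{L}(\kappa)}$, where for each $r$, $L$ is a labeling with $L(v_0)=r$ and $\kappa$ runs over proper colorings $V\to\{1,\dots,\ell\}$ with $\#\kappa^{ -1}(j)=\alpha_j$ for all $j$ and $\kappa(v_0)=i$;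 thus $b_\alpha(q)=\sum_{i:\alpha_i=1}b_\alpha(i;q)$. Notation: $\mathrm{lcomp}(\alpha,i)=(\alpha_1,\dots,\alpha_{i-1})$, $\mathrm{rcomp}(\alpha,i)=(\alpha_{i+1},\dots,\alpha_\ell)$, $L_{\alpha_i}=\alpha_1+\dots+\alpha_{i-1}$, $R_{\alpha_i}=\alpha_{i+1}+\dots+\alpha_\ell$; $\mathrm{mult}(\beta)=\frac{|\beta|!}{\beta_1!\cdots\beta_m!}$ with $\mathrm{mult}(\emptyset)=1$; $[m]_q=1+q+\dots+q^{m-1}$. -}

module Defs where

open import Data.Bool using (Bool; true; false; _∧_; _∨_; not; if_then_else_)
open import Data.Nat using (ℕ; zero; suc; _+_; _*_; _∸_; _≤_; _<ᵇ_; _≡ᵇ_; _≤ᵇ_; _!; _/_; NonZero; _⊓_)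
open import Data.Nat.Properties using (_!≢0; m*n≢0)
open import Data.Nat.Combinatorics using (_C_)
open import Data.Fin using (Fin; toℕ)
open import Data.List using (List; []; _∷_; length; map; concatMap; filterᵇ; all; allFin; upTo; lookup; take; drop)
open import Data.Nat.ListAction using (sum)
open import Data.Product using (_×_)
open import Relation.Binary.PropositionalEquality using (_≡_)
open import Data.Vec using (Vec; []; _∷_) renaming (lookup to vlookup)

-- Polynomials in q with natural coefficients, as coefficient functions
-- (p k = coefficient of q^k).  Equality is pointwise equality.

Poly : Set
Poly = ℕ → ℕ

_⊕_ : Poly → Poly → Poly
(p ⊕ r) k = p k + r k

0ₚ : Poly
0ₚ _ = 0

_·_ : ℕ → Poly → Poly
(c · p) k = c * p k

qpow* : ℕ → Poly → Poly
qpow* l p k = if l ≤ᵇ k then p (k ∸ l) else 0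

qint : ℕ → Poly
qint m k = if k <ᵇ m then 1 else 0

Σℕ≤ : ℕ → (ℕ → ℕ) → ℕ
Σℕ≤ s f = sum (map f (upTo (suc s)))

Σₚ≤ : ℕ → (ℕ → Poly) → Poly
Σₚ≤ zero f = f 0
Σₚ≤ (suc s) f = Σₚ≤ s f ⊕ f (suc s)

Σₚ : {A : Set} → List A → (A → Poly) → Poly
Σₚ [] f = 0ₚ
Σₚ (x ∷ xs) f = f x ⊕ Σₚ xs f

IsComposition : ℕ → List ℕ → Set
IsComposition n α = (all (λ a → 1 ≤ᵇ a) α ≡ true) × (sum α ≡ n)

prodFact : List ℕ → ℕ
prodFact [] = 1
prodFact (b ∷ β) = b ! * prodFact β

prodFact≢0 : (β : List ℕ) → NonZero (prodFact β)
prodFact≢0 [] = _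
prodFact≢0 (b ∷ β) = m*n≢0 (b !) (prodFact β) {{b !≢0}} {{prodFact≢0 β}}

mult : List ℕ → ℕ
mult β = ((sum β) ! / prodFact β) {{prodFact≢0 β}}

-- lcomp(α,i) = (α_1..α_{i-1}),  rcomp(α,i) = (α_{i+1}..α_ℓ)   (i 0-based here)
lcomp : (α : List ℕ) → Fin (length α) → List ℕ
lcomp α i = take (toℕ i) α

rcomp : (α : List ℕ) → Fin (length α) → List ℕ
rcomp α i = drop (suc (toℕ i)) α

Lα : (α : List ℕ) → Fin (length α) → ℕ
Lα α i = sum (lcomp α i)

Rα : (α : List ℕ) → Fin (length α) → ℕ
Rα α i = sum (rcomp α i)

-- Star graph St_n with labelling: vertices are identified with their
-- labels in Fin n (label order = order on Fin n); the root v_0 is the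
-- vertex with label r.  Edges: {r, v} for v ≠ r.
-- Colourings with colours in Fin ℓ (colour j ↔ positive colour j+1).

Colouring : ℕ → ℕ → Set
Colouring n ℓ = Vec (Fin ℓ) n

allColourings : (n ℓ : ℕ) → List (Colouring n ℓ)
allColourings zero ℓ = [] ∷ []
allColourings (suc n) ℓ =
  concatMap (λ c → map (c ∷_) (allColourings n ℓ)) (allFin ℓ)

isProper : {n ℓ : ℕ} → Fin n → Colouring n ℓ → Bool
isProper {n} r κ =
  all (λ v → (toℕ v ≡ᵇ toℕ r) ∨ not (toℕ (vlookup κ v) ≡ᵇ toℕ (vlookup κ r)))
      (allFin n)

asc : {n ℓ : ℕ} → Fin n → Colouring n ℓ → ℕ
asc {n} r κ = length (filterᵇ isAsc (allFin n))
  where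
  isAsc : Fin n → Bool
  isAsc v = ((toℕ v <ᵇ toℕ r) ∧ (toℕ (vlookup κ v) <ᵇ toℕ (vlookup κ r)))
          ∨ ((toℕ r <ᵇ toℕ v) ∧ (toℕ (vlookup κ r) <ᵇ toℕ (vlookup κ v)))

fibreSize : {n ℓ : ℕ} → Colouring n ℓ → Fin ℓ → ℕ
fibreSize {n} κ j = length (filterᵇ (λ v → toℕ (vlookup κ v) ≡ᵇ toℕ j) (allFin n))

hasType : {n : ℕ} (α : List ℕ) → Colouring n (length α) → Bool
hasType α κ = all (λ j → fibreSize κ j ≡ᵇ lookup α j) (allFin (length α))

-- Coefficient of M_α in Tst_n(q) = Σ_r st^r_n(q): since the function is
-- quasisymmetric, this is the coefficient of x_1^{α_1}...x_ℓ^{α_ℓ}, i.e.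
--   Σ_r Σ_{κ proper, V → {1..ℓ}, #κ^{-1}(j) = α_j} q^{asc(κ)}.

bα : (n : ℕ) (α : List ℕ) → Poly
bα n α k = sum (map (λ r → length (filterᵇ
              (λ κ → isProper r κ ∧ hasType α κ ∧ (asc r κ ≡ᵇ k))
              (allColourings n (length α)))) (allFin n))

bαi : (n : ℕ) (α : List ℕ) → Fin (length α) → Poly
bαi n α i k = sum (map (λ r → length (filterᵇ
              (λ κ → isProper r κ ∧ hasType α κ ∧ (toℕ (vlookup κ r) ≡ᵇ toℕ i)
                     ∧ (asc r κ ≡ᵇ k))
              (allColourings n (length α)))) (allFin n))

sα : (α : List ℕ) → Fin (length α) → ℕ
sα α i = Rα α i ⊓ Lα α i

innerPoly : ℕ → ℕ → Poly
innerPoly n s = Σₚ≤ s (λ l → (n C l) · qpow* l (qint (n ∸ 2 * l)))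

termᵢ : ℕ → (α : List ℕ) → Fin (length α) → Poly
termᵢ n α i = (mult (rcomp α i) * mult (lcomp α i)) · innerPoly n (sα α i)

rhsPoly : ℕ → List ℕ → Poly
rhsPoly n α = Σₚ (filterᵇ (λ i → lookup α i ≡ᵇ 1) (allFin (length α))) (termᵢ n α)

-- Fix the colour i of the root v₀. In a proper colouring with κ(v₀) = i every other vertex is
-- coloured below or above i, and its edge to the root is an ascent exactly when the vertex precedes
-- the root in label order and is coloured below i, or follows it and is coloured above i. Hence a
-- colouring of type α is a low/high pattern on the non-root vertices together with a word in the
-- colours below i and a word in the colours above i: the words are counted by mult (lcomp α i) and
-- mult (rcomp α i), the ascents depend only on the pattern and the position of the root, and only
-- indices with α_i = 1 contribute, since only the root has colour i. Summed over the position of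
-- the root, the pattern counts obey the recursion got by removing the first vertex (it is the root,
-- or it precedes the root and is low or high), and the coefficients of
-- Σ_{l ≤ min(L,R)} C(n,l) q^l [n-2l]_q obey the same Pascal-type recursion. For k ≤ (n-1)/2 the
-- window l ≤ k ≤ n-1-l shrinks to l ≤ k.

module Submission where

open import Defs
open import Algebra.Bundles using (Monoid; CommutativeMonoid)
open import Data.Bool using (Bool; true; false; _∧_; _∨_; not; if_then_else_; T)
open import Data.Bool.ListAction using (and)
open import Data.Bool.Properties using (T-≡; ∧-assoc; ∧-zeroʳ; ∧-identityʳ; ∨-identityʳ; ∧-commutativeMonoid)
open import Data.Fin using (Fin; toℕ; zero; suc)
open import Data.Fin.Properties as Fin using (toℕ-injective)
open import Data.List using (List; []; _∷_; _++_; length; lookup; map; concatMap; filterᵇ; allFin; tabulate; take; drop; upTo)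
open import Data.List.Properties using (map-++; map-∘; map-tabulate; tabulate-lookup; upTo-∷ʳ)
open import Data.Nat
  using (ℕ; zero; suc; pred; >-nonZero; _+_; _*_; _∸_; _/_; _!; _⊓_; _≤_; _<_; _<ᵇ_; _≡ᵇ_; _≤ᵇ_; z≤n; s≤s)
open import Data.Nat.Combinatorics using (_C_; nCk+nC[k+1]≡[n+1]C[k+1]; nCk≡nC[n∸k]; nCn≡1)
open import Data.Nat.DivMod using (m*n/n≡m; m/n*n≤m)
open import Data.Nat.ListAction using (sum)
open import Data.Nat.ListAction.Properties using (sum-++)
open import Data.Nat.Properties
open import Data.Nat.Tactic.RingSolver using (solve-∀)
open import Data.Product using (Σ-syntax; _×_; _,_)
open import Data.Sum using (_⊎_; inj₁; inj₂)
open import Data.Vec using ([]; _∷_) renaming (lookup to vlookup)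
open import Function using (_∘_; Equivalence)
open import Relation.Binary.Definitions using (tri<; tri≈; tri>)
open import Relation.Binary.PropositionalEquality
  using (_≡_; _≢_; refl; sym; trans; cong; cong₂; subst; module ≡-Reasoning)
open import Relation.Nullary using (¬_; contradiction; yes; no)
open import Relation.Nullary.Reflects using (Reflects; ofʸ; ofⁿ; fromEquivalence; _×-reflects_)

open import Algebra.Properties.Semiring.Sum +-*-semiring
  using (sum-cong-≗; ∑-distrib-+; ∑-comm; *-distribˡ-sum; *-distribʳ-sum)
  renaming (sum to ∑; sum-replicate-zero to ∑-replicate-zero)
open import Algebra.Properties.CommutativeMonoid.Sum *-1-commutativeMonoid
  using () renaming (sum to ∏; sum-cong-≗ to ∏-cong; ∑-distrib-+ to ∏-distrib-*; sum-replicate-zero to ∏-ones)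
open import Algebra.Properties.CommutativeSemigroup (CommutativeMonoid.commutativeSemigroup ∧-commutativeMonoid)
  using () renaming (interchange to ∧-interchange)
open import Algebra.Properties.CommutativeSemigroup *-commutativeSemigroup
  using () renaming (x∙yz≈y∙xz to m*[n*o]≡n*[m*o])
open import Algebra.Properties.CommutativeSemigroup ⊓-commutativeSemigroup
  using () renaming (interchange to ⊓-interchange)

𝟙 : Bool → ℕ
𝟙 true  = 1
𝟙 false = 0

𝟙-∧ : ∀ a b → 𝟙 (a ∧ b) ≡ 𝟙 a * 𝟙 b
𝟙-∧ true  b = sym (+-identityʳ (𝟙 b))
𝟙-∧ false b = refl

𝟙-* : ∀ b x → 𝟙 b * x ≡ (if b then x else 0)
𝟙-* true  x = +-identityʳ x
𝟙-* false x = refl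

𝟙-∧-third : ∀ a b e d → 𝟙 (a ∧ b ∧ e ∧ d) ≡ 𝟙 e * 𝟙 (a ∧ b ∧ d)
𝟙-∧-third false b     e     d = sym (*-zeroʳ (𝟙 e))
𝟙-∧-third true  false e     d = sym (*-zeroʳ (𝟙 e))
𝟙-∧-third true  true  false d = refl
𝟙-∧-third true  true  true  d = sym (+-identityʳ (𝟙 d))

if-if≡𝟙-∧ : ∀ a b → (if a then (if b then 1 else 0) else 0) ≡ 𝟙 (a ∧ b)
if-if≡𝟙-∧ true  true  = refl
if-if≡𝟙-∧ true  false = refl
if-if≡𝟙-∧ false b     = refl

*-𝟙-∧ : ∀ x a b → x * 𝟙 (a ∧ b) ≡ (if a then x * 𝟙 b else 0)
*-𝟙-∧ x true  b = refl
*-𝟙-∧ x false b = *-zeroʳ x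

𝟙-∧-guard : ∀ u g e a b x → 𝟙 (u ∧ g) * (e * (a * (b * x))) ≡ 𝟙 u * (e * (a * (b * (if g then x else 0))))
𝟙-∧-guard u true  e a b x = cong (λ v → 𝟙 v * (e * (a * (b * x)))) (∧-identityʳ u)
𝟙-∧-guard u false e a b x rewrite ∧-zeroʳ u | *-zeroʳ b | *-zeroʳ a | *-zeroʳ e = sym (*-zeroʳ (𝟙 u))

e*[a*[b*0]]≡0 : ∀ e a b → e * (a * (b * 0)) ≡ 0
e*[a*[b*0]]≡0 e a b rewrite *-zeroʳ b | *-zeroʳ a = *-zeroʳ e

T⇒≡true : ∀ {b} → T b → b ≡ true
T⇒≡true = Equivalence.to T-≡

≡true⇒T : ∀ {b} → b ≡ true → T b
≡true⇒T = Equivalence.from T-≡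

¬T⇒≡false : ∀ {b} → ¬ T b → b ≡ false
¬T⇒≡false {false} _  = refl
¬T⇒≡false {true}  ¬t = contradiction _ ¬t

∧-regroup : ∀ o g u h x e → ((o ∧ g) ∧ (u ∧ h) ∧ (x ∧ e)) ≡ ((o ∧ u ∧ x) ∧ (g ∧ h ∧ e))
∧-regroup o g u h x e = trans (cong ((o ∧ g) ∧_) (∧-interchange u h x e)) (∧-interchange o g (u ∧ x) (h ∧ e))

reflects-≡ : ∀ {A B : Set} {a b} → Reflects A a → Reflects B b → (A → B) → (B → A) → a ≡ b
reflects-≡ (ofʸ _)  (ofʸ _)  _ _ = refl
reflects-≡ (ofⁿ _)  (ofⁿ _)  _ _ = refl
reflects-≡ (ofʸ x)  (ofⁿ ¬y) f _ = contradiction (f x) ¬y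
reflects-≡ (ofⁿ ¬x) (ofʸ y)  _ g = contradiction (g y) ¬x

≡ᵇ-reflects-≡ : ∀ m n → Reflects (m ≡ n) (m ≡ᵇ n)
≡ᵇ-reflects-≡ m n = fromEquivalence (≡ᵇ⇒≡ m n) (≡⇒≡ᵇ m n)

≡ᵇ-comm : ∀ m n → (m ≡ᵇ n) ≡ (n ≡ᵇ m)
≡ᵇ-comm m n = reflects-≡ (≡ᵇ-reflects-≡ m n) (≡ᵇ-reflects-≡ n m) sym sym

≤ᵇ≡<ᵇsuc : ∀ x k → (x ≤ᵇ k) ≡ (x <ᵇ suc k)
≤ᵇ≡<ᵇsuc zero    k = refl
≤ᵇ≡<ᵇsuc (suc x) k = refl

+-≡ᵇ : ∀ x y k → (x + y ≡ᵇ k) ≡ (x ≤ᵇ k) ∧ (y ≡ᵇ k ∸ x)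
+-≡ᵇ zero    y k       = refl
+-≡ᵇ (suc x) y zero    = refl
+-≡ᵇ (suc x) y (suc k) = trans (+-≡ᵇ x y k) (cong (_∧ (y ≡ᵇ k ∸ x)) (≤ᵇ≡<ᵇsuc x k))

0≢ᵇ⇒1≤ : ∀ x → (0 ≡ᵇ x) ≡ false → 1 ≤ x
0≢ᵇ⇒1≤ (suc x) _ = s≤s z≤n

suc[x∸1]≡x : ∀ x → (1 ≤ᵇ x) ≡ true → suc (x ∸ 1) ≡ x
suc[x∸1]≡x (suc x) _ = refl

x!≡[x∸1]!*x : ∀ x → (1 ≤ᵇ x) ≡ true → x ! ≡ (x ∸ 1) ! * x
x!≡[x∸1]!*x (suc x) _ = *-comm (suc x) (x !)

≤ᵇ-false⇒≡0 : ∀ x → (1 ≤ᵇ x) ≡ false → x ≡ 0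
≤ᵇ-false⇒≡0 zero _ = refl

_≡ᶠ_ : ∀ {n} → Fin n → Fin n → Bool
a ≡ᶠ b = toℕ a ≡ᵇ toℕ b

≡ᶠ-reflects-≡ : ∀ {n} (a b : Fin n) → Reflects (a ≡ b) (a ≡ᶠ b)
≡ᶠ-reflects-≡ a b =
  fromEquivalence (toℕ-injective ∘ ≡ᵇ⇒≡ (toℕ a) (toℕ b)) (≡⇒≡ᵇ (toℕ a) (toℕ b) ∘ cong toℕ)

≢⇒≡ᶠfalse : ∀ {n} {a b : Fin n} → a ≢ b → (a ≡ᶠ b) ≡ false
≢⇒≡ᶠfalse a≢b = ¬T⇒≡false (a≢b ∘ toℕ-injective ∘ ≡ᵇ⇒≡ _ _)

≡ᶠ-sym : ∀ {n} (a b : Fin n) → (a ≡ᶠ b) ≡ (b ≡ᶠ a)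
≡ᶠ-sym a b = ≡ᵇ-comm (toℕ a) (toℕ b)

≡ᶠ-refl : ∀ {n} (a : Fin n) → (a ≡ᶠ a) ≡ true
≡ᶠ-refl a = T⇒≡true (≡⇒≡ᵇ (toℕ a) (toℕ a) refl)

e*[a*[b*x]]+e*[b*[a*y]]≡e*[a*[b*[x+y]]] : ∀ e a b x y → e * (a * (b * x)) + e * (b * (a * y)) ≡ e * (a * (b * (x + y)))
e*[a*[b*x]]+e*[b*[a*y]]≡e*[a*[b*[x+y]]] = solve-∀

[p+q]+[c+d]≡[p+d]+[q+c] : ∀ p q c d → (p + q) + (c + d) ≡ (p + d) + (q + c)
[p+q]+[c+d]≡[p+d]+[q+c] = solve-∀

p+c+q≡c+[p+q] : ∀ p c q → p + c + q ≡ c + (p + q)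
p+c+q≡c+[p+q] = solve-∀

d+2l≡l+[d+l] : ∀ d l → d + 2 * l ≡ l + (d + l)
d+2l≡l+[d+l] = solve-∀

module _ {c e} (M : Monoid c e) where
  open Monoid M using (Carrier; _≈_; ε; ∙-congˡ; identityˡ; identityʳ) renaming (trans to ≈-trans)
  open import Algebra.Properties.Monoid.Sum M using (sum-replicate-zero) renaming (sum to ∑ᴹ)

  sum-pick : ∀ {n} (c : Fin n) (g : Fin n → Carrier) → ∑ᴹ (λ j → if j ≡ᶠ c then g j else ε) ≈ g c
  sum-pick {suc n} zero g = ≈-trans (∙-congˡ (sum-replicate-zero n)) (identityʳ (g zero))
  sum-pick (suc c) g = ≈-trans (identityˡ _) (sum-pick c (g ∘ suc))

∑-pick : ∀ {n} (c : Fin n) (g : Fin n → ℕ) → ∑ (λ j → if j ≡ᶠ c then g j else 0) ≡ g c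
∑-pick = sum-pick +-0-monoid

∏-pick : ∀ {n} (c : Fin n) (g : Fin n → ℕ) → ∏ (λ j → if j ≡ᶠ c then g j else 1) ≡ g c
∏-pick = sum-pick *-1-monoid

∑-𝟙-pick : ∀ {n} (c : Fin n) (g : Fin n → ℕ) → ∑ (λ j → 𝟙 (j ≡ᶠ c) * g j) ≡ g c
∑-𝟙-pick c g = trans (sum-cong-≗ λ j → 𝟙-* (j ≡ᶠ c) (g j)) (∑-pick c g)

∑-zero : ∀ {n} {f : Fin n → ℕ} → (∀ j → f j ≡ 0) → ∑ f ≡ 0
∑-zero {n} f≡0 = trans (sum-cong-≗ f≡0) (∑-replicate-zero n)

∑-if : ∀ {n} g (x : Fin n → ℕ) → ∑ (λ r → if g then x r else 0) ≡ (if g then ∑ x else 0)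
∑-if     true  x = refl
∑-if {n} false x = ∑-replicate-zero n

term≤∑ : ∀ {n} (f : Fin n → ℕ) c → f c ≤ ∑ f
term≤∑ f zero    = m≤m+n (f zero) _
term≤∑ f (suc c) = ≤-trans (term≤∑ (f ∘ suc) c) (m≤n+m _ (f zero))

*-distribˡ-∑³ : ∀ {n} e a b (f : Fin n → ℕ) → e * (a * (b * ∑ f)) ≡ ∑ (λ r → e * (a * (b * f r)))
*-distribˡ-∑³ e a b f = trans (cong (λ x → e * (a * x)) (*-distribˡ-sum b f))
  (trans (cong (e *_) (*-distribˡ-sum a (λ r → b * f r))) (*-distribˡ-sum e (λ r → a * (b * f r))))

allᶠ : ∀ {n} → (Fin n → Bool) → Bool
allᶠ {zero}  f = true
allᶠ {suc n} f = f zero ∧ allᶠ (f ∘ suc)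

all-tabulate : ∀ {A : Set} {n} (P : A → Bool) (f : Fin n → A) → and (map P (tabulate f)) ≡ allᶠ (P ∘ f)
all-tabulate {n = zero}  P f = refl
all-tabulate {n = suc n} P f = cong (P (f zero) ∧_) (all-tabulate P (f ∘ suc))

allᶠ-cong : ∀ {n} {f g : Fin n → Bool} → (∀ j → f j ≡ g j) → allᶠ f ≡ allᶠ g
allᶠ-cong {zero}  e = refl
allᶠ-cong {suc n} e = cong₂ _∧_ (e zero) (allᶠ-cong (e ∘ suc))

allᶠ-false : ∀ {n} (f : Fin n → Bool) (j : Fin n) → f j ≡ false → allᶠ f ≡ false
allᶠ-false f zero    e rewrite e = refl
allᶠ-false f (suc j) e rewrite allᶠ-false (f ∘ suc) j e = ∧-zeroʳ (f zero)

allᶠ-true : ∀ {n} (f : Fin n → Bool) → allᶠ f ≡ true → ∀ j → f j ≡ true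
allᶠ-true f e zero    with f zero | e
... | true | _ = refl
allᶠ-true f e (suc j) with f zero | e
... | true | e′ = allᶠ-true (f ∘ suc) e′ j

allᶠ-witness : ∀ {n} (f : Fin n → Bool) → allᶠ f ≡ false → Σ[ j ∈ Fin n ] f j ≡ false
allᶠ-witness {suc n} f e with f zero in eq
... | false = zero , eq
... | true  = let j , fj = allᶠ-witness (f ∘ suc) e in suc j , fj

allᶠ-extract : ∀ {n} (c : Fin n) (g h : Fin n → Bool) (A : Bool) → g c ≡ A ∧ h c →
  (∀ j → j ≢ c → g j ≡ h j) → allᶠ g ≡ A ∧ allᶠ h
allᶠ-extract zero g h A gc≡ off rewrite gc≡ | allᶠ-cong (λ j → off (suc j) λ ()) = ∧-assoc A (h zero) _
allᶠ-extract (suc c) g h A gc≡ off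
  rewrite off zero (λ ()) | allᶠ-extract c (g ∘ suc) (h ∘ suc) A gc≡ (λ j j≢c → off (suc j) (j≢c ∘ Fin.suc-injective))
  with h zero | A
... | true  | _     = refl
... | false | true  = refl
... | false | false = refl

sum-tabulate : ∀ {n} (f : Fin n → ℕ) → sum (tabulate f) ≡ ∑ f
sum-tabulate {zero}  f = refl
sum-tabulate {suc n} f = cong (f zero +_) (sum-tabulate (f ∘ suc))

sum-map-allFin : ∀ n (f : Fin n → ℕ) → sum (map f (allFin n)) ≡ ∑ f
sum-map-allFin n f = trans (cong sum (map-tabulate (λ j → j) f)) (sum-tabulate f)

length-filterᵇ : ∀ {A : Set} (P : A → Bool) (xs : List A) → length (filterᵇ P xs) ≡ sum (map (𝟙 ∘ P) xs)
length-filterᵇ P []       = refl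
length-filterᵇ P (x ∷ xs) with P x
... | true  = cong suc (length-filterᵇ P xs)
... | false = length-filterᵇ P xs

sum-map-concatMap : ∀ {A B : Set} (F : B → ℕ) (f : A → List B) (xs : List A) →
  sum (map F (concatMap f xs)) ≡ sum (map (λ x → sum (map F (f x))) xs)
sum-map-concatMap F f []       = refl
sum-map-concatMap F f (x ∷ xs) = begin
  sum (map F (f x ++ concatMap f xs))            ≡⟨ cong sum (map-++ F (f x) (concatMap f xs)) ⟩
  sum (map F (f x) ++ map F (concatMap f xs))    ≡⟨ sum-++ (map F (f x)) _ ⟩
  sum (map F (f x)) + sum (map F (concatMap f xs)) ≡⟨ cong (sum (map F (f x)) +_) (sum-map-concatMap F f xs) ⟩
  sum (map F (f x)) + sum (map (λ y → sum (map F (f y))) xs) ∎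
  where open ≡-Reasoning

Σₚ-filterᵇ : ∀ {A : Set} (P : A → Bool) (xs : List A) (f : A → Poly) k →
  Σₚ (filterᵇ P xs) f k ≡ sum (map (λ x → 𝟙 (P x) * f x k) xs)
Σₚ-filterᵇ P []       f k = refl
Σₚ-filterᵇ P (x ∷ xs) f k with P x
... | true  = cong₂ _+_ (sym (+-identityʳ (f x k))) (Σₚ-filterᵇ P xs f k)
... | false = Σₚ-filterᵇ P xs f k

∑κ : ∀ {ℓ} n → (Colouring n ℓ → ℕ) → ℕ
∑κ zero    F = F []
∑κ {ℓ} (suc n) F = ∑ {ℓ} λ c → ∑κ n (F ∘ (c ∷_))

sum-allColourings : ∀ {ℓ} n (F : Colouring n ℓ → ℕ) → sum (map F (allColourings n ℓ)) ≡ ∑κ n F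
sum-allColourings zero    F = +-identityʳ (F [])
sum-allColourings {ℓ} (suc n) F = begin
  sum (map F (concatMap (λ c → map (c ∷_) (allColourings n ℓ)) (allFin ℓ)))
    ≡⟨ sum-map-concatMap F _ (allFin ℓ) ⟩
  sum (map (λ c → sum (map F (map (c ∷_) (allColourings n ℓ)))) (allFin ℓ))
    ≡⟨ sum-map-allFin ℓ _ ⟩
  ∑ (λ c → sum (map F (map (c ∷_) (allColourings n ℓ))))
    ≡⟨ sum-cong-≗ (λ c → trans (cong sum (sym (map-∘ (allColourings n ℓ))))
                                (sum-allColourings n (F ∘ (c ∷_)))) ⟩
  ∑κ (suc n) F ∎
  where open ≡-Reasoning

count-as-∑ : ∀ n ℓ (P : Fin n → Colouring n ℓ → Bool) →
  sum (map (λ r → length (filterᵇ (P r) (allColourings n ℓ))) (allFin n)) ≡ ∑ λ r → ∑κ n (𝟙 ∘ P r)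
count-as-∑ n ℓ P = trans (sum-map-allFin n _) (sum-cong-≗ λ r →
  trans (length-filterᵇ (P r) (allColourings n ℓ)) (sum-allColourings n (𝟙 ∘ P r)))

∑κ-cong : ∀ {ℓ} n {F G : Colouring n ℓ → ℕ} → (∀ κ → F κ ≡ G κ) → ∑κ n F ≡ ∑κ n G
∑κ-cong zero    e = e []
∑κ-cong (suc n) e = sum-cong-≗ λ c → ∑κ-cong n (e ∘ (c ∷_))

*-distribˡ-∑κ : ∀ {ℓ} n x (F : Colouring n ℓ → ℕ) → x * ∑κ n F ≡ ∑κ n (λ κ → x * F κ)
*-distribˡ-∑κ zero    x F = refl
*-distribˡ-∑κ (suc n) x F =
  trans (*-distribˡ-sum x (λ c → ∑κ n (F ∘ (c ∷_)))) (sum-cong-≗ λ c → *-distribˡ-∑κ n x (F ∘ (c ∷_)))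

∑κ-comm : ∀ {ℓ m} n (F : Colouring n ℓ → Fin m → ℕ) →
  ∑κ n (λ κ → ∑ (F κ)) ≡ ∑ λ j → ∑κ n (λ κ → F κ j)
∑κ-comm zero    F = refl
∑κ-comm (suc n) F =
  trans (sum-cong-≗ λ c → ∑κ-comm n (F ∘ (c ∷_))) (∑-comm (λ c j → ∑κ n (λ κ → F (c ∷ κ) j)))

-- Words with prescribed content

Content : ℕ → Set
Content ℓ = Fin ℓ → ℕ

_⊖_ : ∀ {ℓ} → Content ℓ → Fin ℓ → Content ℓ
(t ⊖ c) j = if j ≡ᶠ c then t j ∸ 1 else t j

module _ {ℓ : ℕ} where

  ⊖-same : ∀ (t : Content ℓ) c → (t ⊖ c) c ≡ t c ∸ 1
  ⊖-same t c rewrite ≡ᶠ-refl c = refl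

  ⊖-other : ∀ (t : Content ℓ) {c j} → j ≢ c → (t ⊖ c) j ≡ t j
  ⊖-other t {c} {j} j≢c with j ≡ᶠ c | ≡ᶠ-reflects-≡ j c
  ... | false | _       = refl
  ... | true  | ofʸ j≡c = contradiction j≡c j≢c

  size : (Fin ℓ → Bool) → Content ℓ → ℕ
  size P t = ∑ λ j → 𝟙 (P j) * t j

  arrangements : (Fin ℓ → Bool) → Content ℓ → ℕ → ℕ
  arrangements P t zero    = 1
  arrangements P t (suc m) = ∑ λ c → 𝟙 (P c ∧ (1 ≤ᵇ t c)) * arrangements P (t ⊖ c) m

  ∏! : (Fin ℓ → Bool) → Content ℓ → ℕ
  ∏! P t = ∏ λ j → if P j then t j ! else 1

  term≤size : ∀ (P : Fin ℓ → Bool) (t : Content ℓ) c → P c ≡ true → t c ≤ size P t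
  term≤size P t c Pc = begin
    t c           ≡⟨ sym (+-identityʳ (t c)) ⟩
    𝟙 true * t c  ≡⟨ cong (λ b → 𝟙 b * t c) Pc ⟨
    𝟙 (P c) * t c ≤⟨ term≤∑ (λ j → 𝟙 (P j) * t j) c ⟩
    size P t      ∎
    where open ≤-Reasoning

  ⊖-outside : ∀ (P : Fin ℓ → Bool) (t : Content ℓ) {c} → P c ≡ false → ∀ j → P j ≡ true → (t ⊖ c) j ≡ t j
  ⊖-outside P t {c} Pc j Pj with j ≡ᶠ c | ≡ᶠ-reflects-≡ j c
  ... | false | _        = refl
  ... | true  | ofʸ refl = contradiction (trans (sym Pj) Pc) λ ()

  size-cong : ∀ (P : Fin ℓ → Bool) {t t′ : Content ℓ} → (∀ j → P j ≡ true → t j ≡ t′ j) →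
    size P t ≡ size P t′
  size-cong P t≐t′ = sum-cong-≗ λ j → with-P j
    where
    with-P : ∀ j → 𝟙 (P j) * _ ≡ 𝟙 (P j) * _
    with-P j with P j in Pj
    ... | false = refl
    ... | true  = cong (_+ 0) (t≐t′ j Pj)

  arrangements-cong : ∀ (P : Fin ℓ → Bool) {t t′ : Content ℓ} m → (∀ j → P j ≡ true → t j ≡ t′ j) →
    arrangements P t m ≡ arrangements P t′ m
  arrangements-cong P zero    t≐t′ = refl
  arrangements-cong P {t} {t′} (suc m) t≐t′ = sum-cong-≗ with-P
    where
    with-P : ∀ c → 𝟙 (P c ∧ (1 ≤ᵇ t c)) * arrangements P (t ⊖ c) m
                   ≡ 𝟙 (P c ∧ (1 ≤ᵇ t′ c)) * arrangements P (t′ ⊖ c) m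
    with-P c with P c in Pc
    ... | false = refl
    ... | true rewrite t≐t′ c Pc = cong (𝟙 (1 ≤ᵇ t′ c) *_) (arrangements-cong P m λ j Pj →
                                     cong (λ x → if j ≡ᶠ c then x ∸ 1 else x) (t≐t′ j Pj))

  size-⊖ : ∀ (P : Fin ℓ → Bool) (t : Content ℓ) c → P c ≡ true → (1 ≤ᵇ t c) ≡ true →
    size P t ≡ suc (size P (t ⊖ c))
  size-⊖ P t c Pc tc≥1 = begin
    size P t                                                        ≡⟨ sum-cong-≗ split ⟩
    ∑ {ℓ} (λ j → 𝟙 (P j) * (t ⊖ c) j + (if j ≡ᶠ c then 1 else 0)) ≡⟨ ∑-distrib-+ {ℓ} _ _ ⟩
    size P (t ⊖ c) + ∑ {ℓ} (λ j → if j ≡ᶠ c then 1 else 0)             ≡⟨ cong (size P (t ⊖ c) +_) (∑-pick c (λ _ → 1)) ⟩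
    size P (t ⊖ c) + 1                                              ≡⟨ +-comm _ 1 ⟩
    suc (size P (t ⊖ c))                                            ∎
    where
    open ≡-Reasoning
    split : ∀ j → 𝟙 (P j) * t j ≡ 𝟙 (P j) * (t ⊖ c) j + (if j ≡ᶠ c then 1 else 0)
    split j with j ≡ᶠ c | ≡ᶠ-reflects-≡ j c
    ... | false | _        = sym (+-identityʳ _)
    ... | true  | ofʸ refl rewrite Pc = trans (cong (1 *_) (sym (suc[x∸1]≡x (t c) tc≥1))) (+-comm 1 _)

  ∏!-⊖ : ∀ (P : Fin ℓ → Bool) (t : Content ℓ) c → P c ≡ true → (1 ≤ᵇ t c) ≡ true →
    ∏! P t ≡ ∏! P (t ⊖ c) * t c
  ∏!-⊖ P t c Pc tc≥1 = begin
    ∏! P t                                                                         ≡⟨ ∏-cong split ⟩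
    ∏ {ℓ} (λ j → (if P j then (t ⊖ c) j ! else 1) * (if j ≡ᶠ c then t c else 1)) ≡⟨ ∏-distrib-* {ℓ} _ _ ⟩
    ∏! P (t ⊖ c) * ∏ {ℓ} (λ j → if j ≡ᶠ c then t c else 1)                        ≡⟨ cong (∏! P (t ⊖ c) *_) (∏-pick c (λ _ → t c)) ⟩
    ∏! P (t ⊖ c) * t c                                                             ∎
    where
    open ≡-Reasoning
    split : ∀ j → (if P j then t j ! else 1) ≡ (if P j then (t ⊖ c) j ! else 1) * (if j ≡ᶠ c then t c else 1)
    split j with j ≡ᶠ c | ≡ᶠ-reflects-≡ j c
    ... | false | _        = sym (*-identityʳ _)
    ... | true  | ofʸ refl rewrite Pc = x!≡[x∸1]!*x (t c) tc≥1

  arrangements*∏! : ∀ (P : Fin ℓ → Bool) (t : Content ℓ) m → size P t ≡ m → arrangements P t m * ∏! P t ≡ m !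
  arrangements*∏! P t zero size≡0 = trans (+-identityʳ _) (trans (∏-cong factor≡1) (∏-ones ℓ))
    where
    factor≡1 : ∀ j → (if P j then t j ! else 1) ≡ 1
    factor≡1 j with P j in Pj
    ... | false = refl
    ... | true  = cong _! (n≤0⇒n≡0 (subst (t j ≤_) size≡0 (term≤size P t j Pj)))
  arrangements*∏! P t (suc m) size≡1+m = begin
    arrangements P t (suc m) * ∏! P t
      ≡⟨ *-distribʳ-sum (∏! P t) (λ c → 𝟙 (P c ∧ (1 ≤ᵇ t c)) * arrangements P (t ⊖ c) m) ⟩
    ∑ (λ c → 𝟙 (P c ∧ (1 ≤ᵇ t c)) * arrangements P (t ⊖ c) m * ∏! P t)
      ≡⟨ sum-cong-≗ term ⟩
    ∑ (λ c → m ! * (𝟙 (P c) * t c))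
      ≡⟨ *-distribˡ-sum (m !) (λ c → 𝟙 (P c) * t c) ⟨
    m ! * size P t
      ≡⟨ cong (m ! *_) size≡1+m ⟩
    m ! * suc m
      ≡⟨ *-comm (m !) (suc m) ⟩
    suc m ! ∎
    where
    open ≡-Reasoning
    term : ∀ c → 𝟙 (P c ∧ (1 ≤ᵇ t c)) * arrangements P (t ⊖ c) m * ∏! P t ≡ m ! * (𝟙 (P c) * t c)
    term c with P c in Pc | 1 ≤ᵇ t c in tc≥1
    ... | false | _     = sym (*-zeroʳ (m !))
    ... | true  | false = sym (trans (cong (λ x → m ! * (x + 0)) (≤ᵇ-false⇒≡0 (t c) tc≥1)) (*-zeroʳ (m !)))
    ... | true  | true  = begin
      1 * arrangements P (t ⊖ c) m * ∏! P t
        ≡⟨ cong₂ _*_ (*-identityˡ (arrangements P (t ⊖ c) m)) (∏!-⊖ P t c Pc tc≥1) ⟩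
      arrangements P (t ⊖ c) m * (∏! P (t ⊖ c) * t c)
        ≡⟨ *-assoc (arrangements P (t ⊖ c) m) (∏! P (t ⊖ c)) (t c) ⟨
      arrangements P (t ⊖ c) m * ∏! P (t ⊖ c) * t c
        ≡⟨ cong (_* t c) (arrangements*∏! P (t ⊖ c) m (suc-injective (trans (sym (size-⊖ P t c Pc tc≥1)) size≡1+m))) ⟩
      m ! * t c
        ≡⟨ cong (m ! *_) (*-identityˡ (t c)) ⟨
      m ! * (1 * t c) ∎

  arr : (Fin ℓ → Bool) → Content ℓ → ℕ
  arr P t = arrangements P t (size P t)

  arr-cong : ∀ (P : Fin ℓ → Bool) {t t′ : Content ℓ} → (∀ j → P j ≡ true → t j ≡ t′ j) → arr P t ≡ arr P t′
  arr-cong P {t} {t′} t≐t′ = trans (cong (arrangements P t) (size-cong P t≐t′)) (arrangements-cong P (size P t′) t≐t′)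

  arr≡mult : ∀ (P : Fin ℓ → Bool) (t : Content ℓ) (β : List ℕ) → size P t ≡ sum β → ∏! P t ≡ prodFact β →
    arr P t ≡ mult β
  arr≡mult P t β size≡ ∏!≡ = begin
    arr P t                                                        ≡⟨ m*n/n≡m (arr P t) (prodFact β) {{prodFact≢0 β}} ⟨
    ((arr P t * prodFact β) / prodFact β) {{prodFact≢0 β}}        ≡⟨ cong (λ x → (x / prodFact β) {{prodFact≢0 β}}) arr*prodFact ⟩
    mult β                                                         ∎
    where
    open ≡-Reasoning
    arr*prodFact : arr P t * prodFact β ≡ sum β !
    arr*prodFact = trans (cong (arr P t *_) (sym ∏!≡)) (trans (arrangements*∏! P t (size P t) refl) (cong _! size≡))

size-take : ∀ (α : List ℕ) x → ∑ (λ j → 𝟙 (toℕ j <ᵇ x) * lookup α j) ≡ sum (take x α)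
size-take []      zero    = refl
size-take []      (suc x) = refl
size-take (a ∷ α) zero    = ∑-zero {suc (length α)} λ _ → refl
size-take (a ∷ α) (suc x) = cong₂ _+_ (+-identityʳ a) (size-take α x)

size-drop : ∀ (α : List ℕ) x → ∑ (λ j → 𝟙 (x <ᵇ toℕ j) * lookup α j) ≡ sum (drop (suc x) α)
size-drop []      x       = refl
size-drop (a ∷ α) zero    = trans (sum-cong-≗ λ j → *-identityˡ (lookup α j))
                                  (trans (sym (sum-tabulate (lookup α))) (cong sum (tabulate-lookup α)))
size-drop (a ∷ α) (suc x) = size-drop α x

∏!-all : ∀ (α : List ℕ) → ∏ (λ j → lookup α j !) ≡ prodFact α
∏!-all []      = refl
∏!-all (a ∷ α) = cong (a ! *_) (∏!-all α)

∏!-take : ∀ (α : List ℕ) x → ∏ (λ j → if toℕ j <ᵇ x then lookup α j ! else 1) ≡ prodFact (take x α)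
∏!-take []      zero    = refl
∏!-take []      (suc x) = refl
∏!-take (a ∷ α) zero    = trans (+-identityʳ _) (∏-ones (length α))
∏!-take (a ∷ α) (suc x) = cong (a ! *_) (∏!-take α x)

∏!-drop : ∀ (α : List ℕ) x → ∏ (λ j → if x <ᵇ toℕ j then lookup α j ! else 1) ≡ prodFact (drop (suc x) α)
∏!-drop []      x       = refl
∏!-drop (a ∷ α) zero    = trans (+-identityʳ _) (∏!-all α)
∏!-drop (a ∷ α) (suc x) = trans (+-identityʳ _) (∏!-drop α x)

sum-around : ∀ (α : List ℕ) (i : Fin (length α)) →
  sum α ≡ sum (take (toℕ i) α) + (lookup α i + sum (drop (suc (toℕ i)) α))
sum-around (a ∷ α) zero    = refl
sum-around (a ∷ α) (suc i) = trans (cong (a +_) (sum-around α i)) (sym (+-assoc a _ _))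

multiplicity : ∀ {n ℓ} → Colouring n ℓ → Fin ℓ → ℕ
multiplicity κ j = ∑ λ v → 𝟙 (vlookup κ v ≡ᶠ j)

hasContent : ∀ {n ℓ} → Content ℓ → Colouring n ℓ → Bool
hasContent t κ = allᶠ λ j → multiplicity κ j ≡ᵇ t j

hasType≡hasContent : ∀ {n} (α : List ℕ) (κ : Colouring n (length α)) → hasType α κ ≡ hasContent (lookup α) κ
hasType≡hasContent {n} α κ = trans (all-tabulate {n = length α} _ (λ j → j)) (allᶠ-cong λ j →
  cong (_≡ᵇ lookup α j) (trans (length-filterᵇ _ (allFin n)) (sum-map-allFin n _)))

hasContent-∷ : ∀ {n ℓ} (t : Content ℓ) c (κ : Colouring n ℓ) →
  hasContent t (c ∷ κ) ≡ (1 ≤ᵇ t c) ∧ hasContent (t ⊖ c) κ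
hasContent-∷ t c κ = allᶠ-extract c _ _ (1 ≤ᵇ t c) at-c off-c
  where
  at-c : (𝟙 (c ≡ᶠ c) + multiplicity κ c ≡ᵇ t c) ≡ (1 ≤ᵇ t c) ∧ (multiplicity κ c ≡ᵇ (t ⊖ c) c)
  at-c rewrite ≡ᶠ-refl c with t c
  ... | zero  = refl
  ... | suc _ = refl
  off-c : ∀ j → j ≢ c → (𝟙 (c ≡ᶠ j) + multiplicity κ j ≡ᵇ t j) ≡ (multiplicity κ j ≡ᵇ (t ⊖ c) j)
  off-c j j≢c rewrite ≢⇒≡ᶠfalse (j≢c ∘ sym) | ⊖-other t j≢c = refl

-- Low/high patterns around the root

data Side : Set where
  before root after : Side

side : ℕ → ℕ → Side
side zero    zero    = root
side zero    (suc _) = before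
side (suc _) zero    = after
side (suc m) (suc n) = side m n

side-refl : ∀ m → side m m ≡ root
side-refl zero    = refl
side-refl (suc m) = side-refl m

sides : ∀ {n} → Fin n → Fin n → Side
sides r v = side (toℕ v) (toℕ r)

isRoot : Side → Bool
isRoot root = true
isRoot _    = false

isRoot-side : ∀ m n → isRoot (side m n) ≡ (m ≡ᵇ n)
isRoot-side zero    zero    = refl
isRoot-side zero    (suc n) = refl
isRoot-side (suc m) zero    = refl
isRoot-side (suc m) (suc n) = isRoot-side m n

#roots : ∀ {n} → (Fin n → Side) → ℕ
#roots s = ∑ (𝟙 ∘ isRoot ∘ s)

#roots-sides : ∀ {n} (r : Fin n) → #roots (sides r) ≡ 1
#roots-sides r = trans
  (sum-cong-≗ λ v → trans (cong 𝟙 (isRoot-side (toℕ v) (toℕ r))) (sym (*-identityʳ (𝟙 (v ≡ᶠ r)))))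
  (∑-𝟙-pick r (λ _ → 1))

ascentˡ ascentʰ : Side → ℕ
ascentˡ before = 1
ascentˡ _      = 0
ascentʰ after  = 1
ascentʰ _      = 0

onPred : (ℕ → ℕ → ℕ) → ℕ → ℕ → ℕ
onPred G zero    b = 0
onPred G (suc a) b = G a b

lowStep highStep : ℕ → (ℕ → ℕ → ℕ → ℕ) → ℕ → ℕ → ℕ → ℕ
lowStep  d f a b k = onPred (λ a′ b′ → if d ≤ᵇ k then f a′ b′ (k ∸ d) else 0) a b
highStep d f a b k = onPred (λ b′ a′ → if d ≤ᵇ k then f a′ b′ (k ∸ d) else 0) b a

step : Side → (ℕ → ℕ → ℕ → ℕ) → ℕ → ℕ → ℕ → ℕ
step root   f       = f
step before f a b k = lowStep 1 f a b k + highStep 0 f a b k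
step after  f a b k = lowStep 0 f a b k + highStep 1 f a b k

-- Ways to call the non-root vertices low or high, a of them low and b high, with k ascents:
-- a low vertex before the root or a high vertex after it.
patterns : ∀ n → (Fin n → Side) → ℕ → ℕ → ℕ → ℕ
patterns zero    s zero zero zero = 1
patterns zero    s _    _    _    = 0
patterns (suc n) s = step (s zero) (patterns n (s ∘ suc))

patterns-0-empty : ∀ (s : Fin 0 → Side) k → patterns 0 s 0 0 k ≡ 𝟙 (0 ≡ᵇ k)
patterns-0-empty s zero    = refl
patterns-0-empty s (suc k) = refl

patterns-0-high : ∀ (s : Fin 0 → Side) a b k → patterns 0 s a (suc b) k ≡ 0
patterns-0-high s zero    b k = refl
patterns-0-high s (suc a) b k = refl

module RootColour {ℓ : ℕ} (i : Fin ℓ) where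

  low high : Fin ℓ → Bool
  low  c = toℕ c <ᵇ toℕ i
  high c = toℕ i <ᵇ toℕ c

  low⇒< : ∀ {c} → low c ≡ true → toℕ c < toℕ i
  low⇒< lc = <ᵇ⇒< _ _ (≡true⇒T lc)

  high⇒> : ∀ {c} → high c ≡ true → toℕ i < toℕ c
  high⇒> hc = <ᵇ⇒< _ _ (≡true⇒T hc)

  low⇒≢i : ∀ {c} → low c ≡ true → c ≢ i
  low⇒≢i lc c≡i = <-irrefl (cong toℕ c≡i) (low⇒< lc)

  high⇒≢i : ∀ {c} → high c ≡ true → c ≢ i
  high⇒≢i hc c≡i = <-irrefl (cong toℕ (sym c≡i)) (high⇒> hc)

  low⇒¬high : ∀ {c} → low c ≡ true → high c ≡ false
  low⇒¬high lc = ¬T⇒≡false λ hc → <-asym (low⇒< lc) (<ᵇ⇒< _ _ hc)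

  high⇒¬low : ∀ {c} → high c ≡ true → low c ≡ false
  high⇒¬low hc = ¬T⇒≡false λ lc → <-asym (high⇒> hc) (<ᵇ⇒< _ _ lc)

  ¬low-i : low i ≡ false
  ¬low-i = ¬T⇒≡false λ li → <-irrefl refl (<ᵇ⇒< (toℕ i) (toℕ i) li)

  ¬high-i : high i ≡ false
  ¬high-i = ¬low-i

  classify : ∀ c → c ≡ i ⊎ low c ≡ true ⊎ high c ≡ true
  classify c with <-cmp (toℕ c) (toℕ i)
  ... | tri< c<i _ _ = inj₂ (inj₁ (T⇒≡true (<⇒<ᵇ c<i)))
  ... | tri≈ _ c≡i _ = inj₁ (toℕ-injective c≡i)
  ... | tri> _ _ c>i = inj₂ (inj₂ (T⇒≡true (<⇒<ᵇ c>i)))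

  fits : Side → Fin ℓ → Bool
  fits before c = not (c ≡ᶠ i)
  fits root   c = c ≡ᶠ i
  fits after  c = not (c ≡ᶠ i)

  ascent : Side → Fin ℓ → ℕ
  ascent before c = 𝟙 (low c)
  ascent root   c = 0
  ascent after  c = 𝟙 (high c)

  fits-side : ∀ m n c → (m ≡ n → (c ≡ᶠ i) ≡ true) → ((m ≡ᵇ n) ∨ not (c ≡ᶠ i)) ≡ fits (side m n) c
  fits-side zero    zero    c root≡i = sym (root≡i refl)
  fits-side zero    (suc n) c _      = refl
  fits-side (suc m) zero    c _      = refl
  fits-side (suc m) (suc n) c root≡i = fits-side m n c (root≡i ∘ cong suc)

  𝟙-ascent-side : ∀ m n c → 𝟙 (((m <ᵇ n) ∧ low c) ∨ ((n <ᵇ m) ∧ high c)) ≡ ascent (side m n) c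
  𝟙-ascent-side zero    zero    c = refl
  𝟙-ascent-side zero    (suc n) c = cong 𝟙 (∨-identityʳ (low c))
  𝟙-ascent-side (suc m) zero    c = refl
  𝟙-ascent-side (suc m) (suc n) c = 𝟙-ascent-side m n c

  fits-low : ∀ h → h ≢ root → ∀ {c} → low c ≡ true → fits h c ≡ true
  fits-low before _      {c} lc = cong not (≢⇒≡ᶠfalse (low⇒≢i {c} lc))
  fits-low root   h≢root     lc = contradiction refl h≢root
  fits-low after  _      {c} lc = cong not (≢⇒≡ᶠfalse (low⇒≢i {c} lc))

  fits-high : ∀ h → h ≢ root → ∀ {c} → high c ≡ true → fits h c ≡ true
  fits-high before _      {c} hc = cong not (≢⇒≡ᶠfalse (high⇒≢i {c} hc))
  fits-high root   h≢root     hc = contradiction refl h≢root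
  fits-high after  _      {c} hc = cong not (≢⇒≡ᶠfalse (high⇒≢i {c} hc))

  fits-i : ∀ h → h ≢ root → fits h i ≡ false
  fits-i before _      = cong not (≡ᶠ-refl i)
  fits-i root   h≢root = contradiction refl h≢root
  fits-i after  _      = cong not (≡ᶠ-refl i)

  ascent-low : ∀ h {c} → low c ≡ true → ascent h c ≡ ascentˡ h
  ascent-low before lc = cong 𝟙 lc
  ascent-low root   lc = refl
  ascent-low after  lc = cong 𝟙 (low⇒¬high lc)

  ascent-high : ∀ h {c} → high c ≡ true → ascent h c ≡ ascentʰ h
  ascent-high before hc = cong 𝟙 (high⇒¬low hc)
  ascent-high root   hc = refl
  ascent-high after  hc = cong 𝟙 hc

  fitsAll : ∀ {n} → (Fin n → Side) → Colouring n ℓ → Bool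
  fitsAll s κ = allᶠ λ v → fits (s v) (vlookup κ v)

  ascents : ∀ {n} → (Fin n → Side) → Colouring n ℓ → ℕ
  ascents s κ = ∑ λ v → ascent (s v) (vlookup κ v)

  module _ {n} (r : Fin n) (κ : Colouring n ℓ) (κr≡i : toℕ (vlookup κ r) ≡ toℕ i) where

    isProper≡fitsAll : isProper r κ ≡ fitsAll (sides r) κ
    isProper≡fitsAll = trans (all-tabulate {n = n} _ (λ v → v)) (allᶠ-cong λ v →
      trans (cong (λ x → (toℕ v ≡ᵇ toℕ r) ∨ not (toℕ (vlookup κ v) ≡ᵇ x)) κr≡i)
            (fits-side (toℕ v) (toℕ r) (vlookup κ v) λ v≡r →
              T⇒≡true (≡⇒≡ᵇ _ _ (subst (λ w → toℕ (vlookup κ w) ≡ toℕ i) (sym (toℕ-injective v≡r)) κr≡i))))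

    asc≡ascents : asc r κ ≡ ascents (sides r) κ
    asc≡ascents = trans (length-filterᵇ _ (allFin n)) (trans (sum-map-allFin n _) (sum-cong-≗ λ v →
      trans (cong (λ x → 𝟙 (((toℕ v <ᵇ toℕ r) ∧ (toℕ (vlookup κ v) <ᵇ x))
                             ∨ ((toℕ r <ᵇ toℕ v) ∧ (x <ᵇ toℕ (vlookup κ v))))) κr≡i)
            (𝟙-ascent-side (toℕ v) (toℕ r) (vlookup κ v))))

  proper∧rootColour≡fitsAll : ∀ {n} (r : Fin n) (κ : Colouring n ℓ) (B : Bool) (k : ℕ) →
    (isProper r κ ∧ B ∧ (vlookup κ r ≡ᶠ i) ∧ (asc r κ ≡ᵇ k))
      ≡ (fitsAll (sides r) κ ∧ B ∧ (ascents (sides r) κ ≡ᵇ k))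
  proper∧rootColour≡fitsAll r κ B k
    with vlookup κ r ≡ᶠ i in κr≡ᵇi | ≡ᵇ-reflects-≡ (toℕ (vlookup κ r)) (toℕ i)
  ... | true  | ofʸ κr≡i rewrite isProper≡fitsAll r κ κr≡i | asc≡ascents r κ κr≡i = refl
  ... | false | ofⁿ _
    rewrite allᶠ-false (λ v → fits (sides r v) (vlookup κ v)) r
              (trans (cong (λ s → fits s (vlookup κ r)) (side-refl (toℕ r))) κr≡ᵇi)
    = trans (cong (isProper r κ ∧_) (∧-zeroʳ B)) (∧-zeroʳ (isProper r κ))

  fittingColourings : ∀ {n} → (Fin n → Side) → Content ℓ → ℕ → ℕ
  fittingColourings {n} s t k = ∑κ n λ κ → 𝟙 (fitsAll s κ ∧ hasContent t κ ∧ (ascents s κ ≡ᵇ k))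

  admissible : Side → Content ℓ → ℕ → Fin ℓ → Bool
  admissible h t k c = fits h c ∧ (1 ≤ᵇ t c) ∧ (ascent h c ≤ᵇ k)

  fittingColourings-suc : ∀ {n} (s : Fin (suc n) → Side) t k →
    fittingColourings s t k
      ≡ ∑ λ c → 𝟙 (admissible (s zero) t k c) * fittingColourings (s ∘ suc) (t ⊖ c) (k ∸ ascent (s zero) c)
  fittingColourings-suc {n} s t k = sum-cong-≗ λ c →
    trans (∑κ-cong n (split c)) (sym (*-distribˡ-∑κ n (𝟙 (admissible (s zero) t k c)) (rest c)))
    where
    rest : Fin ℓ → Colouring n ℓ → ℕ
    rest c κ = 𝟙 (fitsAll (s ∘ suc) κ ∧ hasContent (t ⊖ c) κ ∧ (ascents (s ∘ suc) κ ≡ᵇ k ∸ ascent (s zero) c))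
    split : ∀ c κ →
      𝟙 ((fits (s zero) c ∧ fitsAll (s ∘ suc) κ) ∧ hasContent t (c ∷ κ)
         ∧ (ascent (s zero) c + ascents (s ∘ suc) κ ≡ᵇ k))
        ≡ 𝟙 (admissible (s zero) t k c) * rest c κ
    split c κ rewrite hasContent-∷ t c κ | +-≡ᵇ (ascent (s zero) c) (ascents (s ∘ suc) κ) k =
      trans (cong 𝟙 (∧-regroup (fits (s zero) c) (fitsAll (s ∘ suc) κ) (1 ≤ᵇ t c) (hasContent (t ⊖ c) κ)
                               (ascent (s zero) c ≤ᵇ k) (ascents (s ∘ suc) κ ≡ᵇ k ∸ ascent (s zero) c)))
            (𝟙-∧ (admissible (s zero) t k c)
                 (fitsAll (s ∘ suc) κ ∧ hasContent (t ⊖ c) κ ∧ (ascents (s ∘ suc) κ ≡ᵇ k ∸ ascent (s zero) c)))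

  factorisedCount : ∀ {n} → (Fin n → Side) → Content ℓ → ℕ → ℕ
  factorisedCount {n} s t k =
    𝟙 (t i ≡ᵇ #roots s) * (arr low t * (arr high t * patterns n s (size low t) (size high t) k))

  factorisedCount-cong : ∀ {n} (s : Fin n → Side) {t t′ : Content ℓ} k →
    (∀ c → low c ≡ true → t c ≡ t′ c) → (∀ c → high c ≡ true → t c ≡ t′ c) →
    factorisedCount s t k
      ≡ 𝟙 (t i ≡ᵇ #roots s) * (arr low t′ * (arr high t′ * patterns n s (size low t′) (size high t′) k))
  factorisedCount-cong {n} s {t} k t≐ˡt′ t≐ʰt′ = cong (𝟙 (t i ≡ᵇ #roots s) *_)
    (cong₂ _*_ (arr-cong low t≐ˡt′) (cong₂ _*_ (arr-cong high t≐ʰt′)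
      (cong₂ (λ a b → patterns n s a b k) (size-cong low t≐ˡt′) (size-cong high t≐ʰt′))))

  factorisedCount-sizes : ∀ {n} (s : Fin n → Side) t k {L H} → size low t ≡ L → size high t ≡ H →
    factorisedCount s t k ≡ 𝟙 (t i ≡ᵇ #roots s) * (arrangements low t L * (arrangements high t H * patterns n s L H k))
  factorisedCount-sizes s t k refl refl = refl

  module _ (P Q : Fin ℓ → Bool) (P⇒≢i : ∀ {c} → P c ≡ true → c ≢ i)
           (P⇒¬Q : ∀ {c} → P c ≡ true → Q c ≡ false) where

    ∑-firstLetter : ∀ (t : Content ℓ) R (G : ℕ → ℕ → ℕ) →
      ∑ (λ c → 𝟙 (P c ∧ (1 ≤ᵇ t c))
               * (𝟙 ((t ⊖ c) i ≡ᵇ R) * (arr P (t ⊖ c) * (arr Q (t ⊖ c) * G (size P (t ⊖ c)) (size Q (t ⊖ c))))))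
        ≡ 𝟙 (t i ≡ᵇ R) * (arr P t * (arr Q t * onPred G (size P t) (size Q t)))
    ∑-firstLetter t R G = go (size P t) refl
      where
      summand : Fin ℓ → ℕ
      summand c = 𝟙 ((t ⊖ c) i ≡ᵇ R) * (arr P (t ⊖ c) * (arr Q (t ⊖ c) * G (size P (t ⊖ c)) (size Q (t ⊖ c))))

      go : ∀ m → size P t ≡ m → ∑ (λ c → 𝟙 (P c ∧ (1 ≤ᵇ t c)) * summand c)
                                  ≡ 𝟙 (t i ≡ᵇ R) * (arrangements P t m * (arr Q t * onPred G m (size Q t)))
      go zero size≡0 = trans (∑-zero vanish) (sym (trans (cong (λ x → 𝟙 (t i ≡ᵇ R) * (1 * x)) (*-zeroʳ (arr Q t)))
                                                          (*-zeroʳ (𝟙 (t i ≡ᵇ R)))))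
        where
        vanish : ∀ c → 𝟙 (P c ∧ (1 ≤ᵇ t c)) * summand c ≡ 0
        vanish c with P c in Pc
        ... | false = refl
        ... | true rewrite n≤0⇒n≡0 (subst (t c ≤_) size≡0 (term≤size P t c Pc)) = refl
      go (suc m) size≡1+m = begin
        ∑ (λ c → 𝟙 (P c ∧ (1 ≤ᵇ t c)) * summand c)
          ≡⟨ sum-cong-≗ term ⟩
        ∑ (λ c → 𝟙 (P c ∧ (1 ≤ᵇ t c)) * arrangements P (t ⊖ c) m * K)
          ≡⟨ *-distribʳ-sum K (λ c → 𝟙 (P c ∧ (1 ≤ᵇ t c)) * arrangements P (t ⊖ c) m) ⟨
        arrangements P t (suc m) * K
          ≡⟨ m*[n*o]≡n*[m*o] (arrangements P t (suc m)) (𝟙 (t i ≡ᵇ R)) (arr Q t * G m (size Q t)) ⟩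
        𝟙 (t i ≡ᵇ R) * (arrangements P t (suc m) * (arr Q t * G m (size Q t))) ∎
        where
        open ≡-Reasoning
        K : ℕ
        K = 𝟙 (t i ≡ᵇ R) * (arr Q t * G m (size Q t))
        term : ∀ c → 𝟙 (P c ∧ (1 ≤ᵇ t c)) * (𝟙 ((t ⊖ c) i ≡ᵇ R) * (arrangements P (t ⊖ c) (size P (t ⊖ c))
                       * (arrangements Q (t ⊖ c) (size Q (t ⊖ c)) * G (size P (t ⊖ c)) (size Q (t ⊖ c)))))
                   ≡ 𝟙 (P c ∧ (1 ≤ᵇ t c)) * arrangements P (t ⊖ c) m * K
        term c with P c in Pc | 1 ≤ᵇ t c in tc≥1
        ... | false | _     = refl
        ... | true  | false = refl
        ... | true  | true
          rewrite ⊖-other t {c} {i} (P⇒≢i Pc ∘ sym)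
                | size-cong Q (⊖-outside Q t (P⇒¬Q Pc))
                | arrangements-cong Q (size Q t) (⊖-outside Q t (P⇒¬Q Pc))
                | suc-injective (trans (sym (size-⊖ P t c Pc tc≥1)) size≡1+m)
          = trans (*-identityˡ _) (trans (m*[n*o]≡n*[m*o] (𝟙 (t i ≡ᵇ R)) (arrangements P (t ⊖ c) m) _)
                                         (cong (_* K) (sym (*-identityˡ (arrangements P (t ⊖ c) m)))))

  ∑-by-class : ∀ (g : Fin ℓ → ℕ) → g i ≡ 0 →
    ∑ g ≡ ∑ (λ c → 𝟙 (low c) * g c) + ∑ (λ c → 𝟙 (high c) * g c)
  ∑-by-class g gi≡0 = trans (sum-cong-≗ split) (∑-distrib-+ (λ c → 𝟙 (low c) * g c) (λ c → 𝟙 (high c) * g c))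
    where
    split : ∀ c → g c ≡ 𝟙 (low c) * g c + 𝟙 (high c) * g c
    split c with classify c
    ... | inj₁ refl      rewrite gi≡0 = sym (cong₂ _+_ (*-zeroʳ (𝟙 (low i))) (*-zeroʳ (𝟙 (high i))))
    ... | inj₂ (inj₁ lc) = sym (trans (cong₂ (λ a b → 𝟙 a * g c + 𝟙 b * g c) lc (low⇒¬high lc))
                                      (trans (+-identityʳ _) (+-identityʳ (g c))))
    ... | inj₂ (inj₂ hc) = sym (trans (cong₂ (λ a b → 𝟙 a * g c + 𝟙 b * g c) (high⇒¬low hc) hc)
                                      (+-identityʳ (g c)))

  rootCase : ∀ {n} (s : Fin n → Side) t k →
    ∑ (λ c → 𝟙 (admissible root t k c) * factorisedCount s (t ⊖ c) k)
      ≡ 𝟙 (t i ≡ᵇ suc (#roots s)) * (arr low t * (arr high t * patterns n s (size low t) (size high t) k))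
  rootCase {n} s t k = begin
    ∑ (λ c → 𝟙 (admissible root t k c) * factorisedCount s (t ⊖ c) k)
      ≡⟨ sum-cong-≗ (λ c → trans (cong (_* factorisedCount s (t ⊖ c) k) (𝟙-∧ (c ≡ᶠ i) _))
                                  (*-assoc (𝟙 (c ≡ᶠ i)) (𝟙 ((1 ≤ᵇ t c) ∧ true)) (factorisedCount s (t ⊖ c) k))) ⟩
    ∑ (λ c → 𝟙 (c ≡ᶠ i) * (𝟙 ((1 ≤ᵇ t c) ∧ true) * factorisedCount s (t ⊖ c) k))
      ≡⟨ ∑-𝟙-pick i (λ c → 𝟙 ((1 ≤ᵇ t c) ∧ true) * factorisedCount s (t ⊖ c) k) ⟩
    𝟙 ((1 ≤ᵇ t i) ∧ true) * factorisedCount s (t ⊖ i) k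
      ≡⟨ cong (𝟙 ((1 ≤ᵇ t i) ∧ true) *_)
              (factorisedCount-cong s k (⊖-outside low t ¬low-i) (⊖-outside high t ¬high-i)) ⟩
    𝟙 ((1 ≤ᵇ t i) ∧ true) * (𝟙 ((t ⊖ i) i ≡ᵇ #roots s) * Z)
      ≡⟨ cong (λ x → 𝟙 ((1 ≤ᵇ t i) ∧ true) * (𝟙 (x ≡ᵇ #roots s) * Z)) (⊖-same t i) ⟩
    𝟙 ((1 ≤ᵇ t i) ∧ true) * (𝟙 (t i ∸ 1 ≡ᵇ #roots s) * Z)
      ≡⟨ decrement (t i) ⟩
    𝟙 (t i ≡ᵇ suc (#roots s)) * Z ∎
    where
    open ≡-Reasoning
    Z : ℕ
    Z = arr low t * (arr high t * patterns n s (size low t) (size high t) k)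
    decrement : ∀ x → 𝟙 ((1 ≤ᵇ x) ∧ true) * (𝟙 (x ∸ 1 ≡ᵇ #roots s) * Z) ≡ 𝟙 (x ≡ᵇ suc (#roots s)) * Z
    decrement zero    = refl
    decrement (suc x) = +-identityʳ _

  module NonRoot {n} (h : Side) (h≢root : h ≢ root) (s : Fin n → Side) (t : Content ℓ) (k : ℕ) where

    term : Fin ℓ → ℕ
    term c = 𝟙 (admissible h t k c) * factorisedCount s (t ⊖ c) (k ∸ ascent h c)

    guarded : ℕ → Content ℓ → ℕ
    guarded d t′ = if d ≤ᵇ k then patterns n s (size low t′) (size high t′) (k ∸ d) else 0

    Gˡ Gʰ : ℕ → ℕ → ℕ
    Gˡ a b = if ascentˡ h ≤ᵇ k then patterns n s a b (k ∸ ascentˡ h) else 0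
    Gʰ b a = if ascentʰ h ≤ᵇ k then patterns n s a b (k ∸ ascentʰ h) else 0

    term-i : term i ≡ 0
    term-i rewrite fits-i h h≢root = refl

    admissible-term : ∀ c {d} → fits h c ≡ true → ascent h c ≡ d →
      term c ≡ 𝟙 (1 ≤ᵇ t c)
                 * (𝟙 ((t ⊖ c) i ≡ᵇ #roots s) * (arr low (t ⊖ c) * (arr high (t ⊖ c) * guarded d (t ⊖ c))))
    admissible-term c {d} fits≡ ascent≡ =
      trans (cong₂ (λ b a → 𝟙 (b ∧ (1 ≤ᵇ t c) ∧ (a ≤ᵇ k)) * factorisedCount s (t ⊖ c) (k ∸ a)) fits≡ ascent≡)
            (𝟙-∧-guard (1 ≤ᵇ t c) (d ≤ᵇ k) (𝟙 ((t ⊖ c) i ≡ᵇ #roots s)) (arr low (t ⊖ c)) (arr high (t ⊖ c))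
                       (patterns n s (size low (t ⊖ c)) (size high (t ⊖ c)) (k ∸ d)))

    lowTerm : ∀ c → 𝟙 (low c) * term c ≡ 𝟙 (low c ∧ (1 ≤ᵇ t c))
      * (𝟙 ((t ⊖ c) i ≡ᵇ #roots s) * (arr low (t ⊖ c) * (arr high (t ⊖ c) * Gˡ (size low (t ⊖ c)) (size high (t ⊖ c)))))
    lowTerm c with low c in lc
    ... | false = refl
    ... | true  = trans (*-identityˡ (term c)) (admissible-term c (fits-low h h≢root {c} lc) (ascent-low h {c} lc))

    highTerm : ∀ c → 𝟙 (high c) * term c ≡ 𝟙 (high c ∧ (1 ≤ᵇ t c))
      * (𝟙 ((t ⊖ c) i ≡ᵇ #roots s) * (arr high (t ⊖ c) * (arr low (t ⊖ c) * Gʰ (size high (t ⊖ c)) (size low (t ⊖ c)))))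
    highTerm c with high c in hc
    ... | false = refl
    ... | true  = trans (*-identityˡ (term c)) (trans (admissible-term c (fits-high h h≢root {c} hc) (ascent-high h {c} hc))
      (cong (λ z → 𝟙 (1 ≤ᵇ t c) * (𝟙 ((t ⊖ c) i ≡ᵇ #roots s) * z))
            (m*[n*o]≡n*[m*o] (arr low (t ⊖ c)) (arr high (t ⊖ c)) (guarded (ascentʰ h) (t ⊖ c)))))

    nonRootCase : ∑ term ≡ 𝟙 (t i ≡ᵇ #roots s) * (arr low t * (arr high t
                    * (lowStep (ascentˡ h) (patterns n s) (size low t) (size high t) k
                       + highStep (ascentʰ h) (patterns n s) (size low t) (size high t) k)))
    nonRootCase = begin
      ∑ term
        ≡⟨ ∑-by-class term term-i ⟩
      ∑ (λ c → 𝟙 (low c) * term c) + ∑ (λ c → 𝟙 (high c) * term c)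
        ≡⟨ cong₂ _+_ (trans (sum-cong-≗ lowTerm) (∑-firstLetter low high low⇒≢i low⇒¬high t (#roots s) Gˡ))
                     (trans (sum-cong-≗ highTerm) (∑-firstLetter high low high⇒≢i high⇒¬low t (#roots s) Gʰ)) ⟩
      𝟙 (t i ≡ᵇ #roots s) * (arr low t * (arr high t * onPred Gˡ (size low t) (size high t)))
        + 𝟙 (t i ≡ᵇ #roots s) * (arr high t * (arr low t * onPred Gʰ (size high t) (size low t)))
        ≡⟨ e*[a*[b*x]]+e*[b*[a*y]]≡e*[a*[b*[x+y]]] (𝟙 (t i ≡ᵇ #roots s)) (arr low t) (arr high t)
             (onPred Gˡ (size low t) (size high t)) (onPred Gʰ (size high t) (size low t)) ⟩
      𝟙 (t i ≡ᵇ #roots s) * (arr low t * (arr high t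
        * (onPred Gˡ (size low t) (size high t) + onPred Gʰ (size high t) (size low t)))) ∎
      where open ≡-Reasoning

  factorisedCount-step : ∀ {n} h (s : Fin n → Side) t k →
    ∑ (λ c → 𝟙 (admissible h t k c) * factorisedCount s (t ⊖ c) (k ∸ ascent h c))
      ≡ 𝟙 (t i ≡ᵇ 𝟙 (isRoot h) + #roots s) * (arr low t * (arr high t * step h (patterns n s) (size low t) (size high t) k))
  factorisedCount-step before s t k = NonRoot.nonRootCase before (λ ()) s t k
  factorisedCount-step root   s t k = rootCase s t k
  factorisedCount-step after  s t k = NonRoot.nonRootCase after (λ ()) s t k

  fittingColourings₀ : ∀ (s : Fin 0 → Side) t k → fittingColourings s t k ≡ factorisedCount s t k
  fittingColourings₀ s t k with allᶠ (λ j → 0 ≡ᵇ t j) in all≡0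
  ... | true = sym (begin
    factorisedCount s t k                            ≡⟨ factorisedCount-sizes s t k (size≡0 low) (size≡0 high) ⟩
    𝟙 (t i ≡ᵇ 0) * (1 * (1 * patterns 0 s 0 0 k))   ≡⟨ cong (λ x → 𝟙 (x ≡ᵇ 0) * (1 * (1 * patterns 0 s 0 0 k))) (t≡0 i) ⟩
    1 * (1 * (1 * patterns 0 s 0 0 k))               ≡⟨ trans (*-identityˡ _) (trans (*-identityˡ _) (*-identityˡ _)) ⟩
    patterns 0 s 0 0 k                               ≡⟨ patterns-0-empty s k ⟩
    𝟙 (0 ≡ᵇ k)                                       ∎)
    where
    open ≡-Reasoning
    t≡0 : ∀ j → t j ≡ 0
    t≡0 j = sym (≡ᵇ⇒≡ 0 (t j) (≡true⇒T (allᶠ-true _ all≡0 j)))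
    size≡0 : ∀ P → size P t ≡ 0
    size≡0 P = ∑-zero λ j → trans (cong (𝟙 (P j) *_) (t≡0 j)) (*-zeroʳ (𝟙 (P j)))
  ... | false with allᶠ-witness _ all≡0
  ... | j , 0≢tj with classify j
  ... | inj₁ refl = sym (cong (λ b → 𝟙 b * (arr low t * (arr high t * patterns 0 s (size low t) (size high t) k)))
                             (trans (≡ᵇ-comm (t i) 0) 0≢tj))
  ... | inj₂ (inj₁ lj) = sym (trans (factorisedCount-sizes s t k (sym (suc-pred _ {{>-nonZero size>0}})) refl)
                                    (e*[a*[b*0]]≡0 (𝟙 (t i ≡ᵇ 0)) (arrangements low t (suc (pred (size low t)))) (arr high t)))
    where
    size>0 : 0 < size low t
    size>0 = ≤-trans (0≢ᵇ⇒1≤ (t j) 0≢tj) (term≤size low t j lj)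
  ... | inj₂ (inj₂ hj) = sym (trans (factorisedCount-sizes s t k refl (sym (suc-pred _ {{>-nonZero size>0}})))
                                    (trans (cong (λ x → 𝟙 (t i ≡ᵇ 0) * (arr low t * (A * x)))
                                                 (patterns-0-high s (size low t) _ k))
                                           (e*[a*[b*0]]≡0 (𝟙 (t i ≡ᵇ 0)) (arr low t) A)))
    where
    size>0 : 0 < size high t
    size>0 = ≤-trans (0≢ᵇ⇒1≤ (t j) 0≢tj) (term≤size high t j hj)
    A : ℕ
    A = arrangements high t (suc (pred (size high t)))

  fittingColourings≡factorisedCount : ∀ {n} (s : Fin n → Side) t k → fittingColourings s t k ≡ factorisedCount s t k
  fittingColourings≡factorisedCount {zero}  = fittingColourings₀
  fittingColourings≡factorisedCount {suc n} s t k = begin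
    fittingColourings s t k
      ≡⟨ fittingColourings-suc s t k ⟩
    ∑ (λ c → 𝟙 (admissible (s zero) t k c) * fittingColourings (s ∘ suc) (t ⊖ c) (k ∸ ascent (s zero) c))
      ≡⟨ sum-cong-≗ (λ c → cong (𝟙 (admissible (s zero) t k c) *_)
                                (fittingColourings≡factorisedCount (s ∘ suc) (t ⊖ c) (k ∸ ascent (s zero) c))) ⟩
    ∑ (λ c → 𝟙 (admissible (s zero) t k c) * factorisedCount (s ∘ suc) (t ⊖ c) (k ∸ ascent (s zero) c))
      ≡⟨ factorisedCount-step (s zero) (s ∘ suc) t k ⟩
    factorisedCount s t k ∎
    where open ≡-Reasoning

-- Truncated sums of binomial coefficients

_C≤_ : ℕ → ℕ → ℕ
N C≤ zero  = N C 0
N C≤ suc m = N C≤ m + N C suc m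

C≤-pascal : ∀ N m → suc N C≤ suc m ≡ N C≤ suc m + N C≤ m
C≤-pascal N zero = begin
  1 + suc N C 1           ≡⟨ cong (1 +_) (nCk+nC[k+1]≡[n+1]C[k+1] N 0) ⟨
  1 + (1 + N C 1)         ≡⟨ +-comm 1 (1 + N C 1) ⟩
  N C≤ 1 + N C≤ 0         ∎
  where open ≡-Reasoning
C≤-pascal N (suc m) = begin
  suc N C≤ suc m + suc N C suc (suc m)
    ≡⟨ cong₂ _+_ (C≤-pascal N m) (sym (nCk+nC[k+1]≡[n+1]C[k+1] N (suc m))) ⟩
  (N C≤ suc m + N C≤ m) + (N C suc m + N C suc (suc m))
    ≡⟨ [p+q]+[c+d]≡[p+d]+[q+c] (N C≤ suc m) (N C≤ m) (N C suc m) (N C suc (suc m)) ⟩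
  N C≤ suc (suc m) + N C≤ suc m ∎
  where open ≡-Reasoning

C≤-⊓-suc : ∀ N s m → N C≤ (s ⊓ m) + (N C suc s) * 𝟙 (suc s ≤ᵇ m) ≡ N C≤ (suc s ⊓ m)
C≤-⊓-suc N s m with suc s ≤ᵇ m | ≤ᵇ-reflects-≤ (suc s) m
... | true  | ofʸ s<m  = trans (cong₂ _+_ (cong (N C≤_) (m≤n⇒m⊓n≡m (<⇒≤ s<m))) (*-identityʳ (N C suc s)))
                                (cong (N C≤_) (sym (m≤n⇒m⊓n≡m s<m)))
... | false | ofⁿ s≮m = trans (cong₂ _+_ (cong (N C≤_) (m≥n⇒m⊓n≡n (≤-pred (≰⇒> s≮m)))) (*-zeroʳ (N C suc s)))
                                (trans (+-identityʳ (N C≤ m)) (cong (N C≤_) (sym (m≥n⇒m⊓n≡n (<⇒≤ (≰⇒> s≮m))))))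

Σℕ≤-suc : ∀ s (f : ℕ → ℕ) → Σℕ≤ (suc s) f ≡ Σℕ≤ s f + f (suc s)
Σℕ≤-suc s f = begin
  sum (map f (upTo (suc (suc s))))             ≡⟨ cong (sum ∘ map f) (upTo-∷ʳ (suc s)) ⟨
  sum (map f (upTo (suc s) ++ suc s ∷ []))      ≡⟨ cong sum (map-++ f (upTo (suc s)) (suc s ∷ [])) ⟩
  sum (map f (upTo (suc s)) ++ f (suc s) ∷ [])  ≡⟨ sum-++ (map f (upTo (suc s))) (f (suc s) ∷ []) ⟩
  Σℕ≤ s f + (f (suc s) + 0)                     ≡⟨ cong (Σℕ≤ s f +_) (+-identityʳ (f (suc s))) ⟩
  Σℕ≤ s f + f (suc s)                           ∎
  where open ≡-Reasoning

Σℕ≤≡C≤ : ∀ N s → Σℕ≤ s (N C_) ≡ N C≤ s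
Σℕ≤≡C≤ N zero    = +-identityʳ (N C 0)
Σℕ≤≡C≤ N (suc s) = trans (Σℕ≤-suc s (N C_)) (cong (_+ (N C suc s)) (Σℕ≤≡C≤ N s))

-- q^k occurs in q^l [N + 1 - 2l]_q exactly when l ≤ k ≤ N - l.
in-window : ∀ N k l → ((l ≤ᵇ k) ∧ (k ∸ l <ᵇ suc N ∸ 2 * l)) ≡ ((k ≤ᵇ N) ∧ (l ≤ᵇ k ⊓ (N ∸ k)))
in-window N k l = reflects-≡ (≤ᵇ-reflects-≤ l k ×-reflects <ᵇ-reflects-< (k ∸ l) (suc N ∸ 2 * l))
                             (≤ᵇ-reflects-≤ k N ×-reflects ≤ᵇ-reflects-≤ l (k ⊓ (N ∸ k)))
                             to from
  where
  shift : l ≤ k → suc (k ∸ l) + 2 * l ≡ suc (l + k)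
  shift l≤k = cong suc (trans (d+2l≡l+[d+l] (k ∸ l) l) (cong (l +_) (m∸n+n≡m l≤k)))
  to : l ≤ k × k ∸ l < suc N ∸ 2 * l → k ≤ N × l ≤ k ⊓ (N ∸ k)
  to (l≤k , lt) = m+n≤o⇒n≤o l l+k≤N , ⊓-glb l≤k (m+n≤o⇒m≤o∸n l l+k≤N)
    where
    2l≤1+N : 2 * l ≤ suc N
    2l≤1+N = <⇒≤ (m∸n≢0⇒n<m λ eq → contradiction (subst (k ∸ l <_) eq lt) λ ())
    l+k≤N : l + k ≤ N
    l+k≤N = ≤-pred (subst (_≤ suc N) (shift l≤k) (m≤o∸n⇒m+n≤o (suc (k ∸ l)) 2l≤1+N lt))
  from : k ≤ N × l ≤ k ⊓ (N ∸ k) → l ≤ k × k ∸ l < suc N ∸ 2 * l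
  from (k≤N , l≤) = l≤k , m+n≤o⇒m≤o∸n (suc (k ∸ l)) (subst (_≤ suc N) (sym (shift l≤k)) (s≤s l+k≤N))
    where
    l≤k : l ≤ k
    l≤k = ≤-trans l≤ (m⊓n≤m k (N ∸ k))
    l+k≤N : l + k ≤ N
    l+k≤N = m≤o∸n⇒m+n≤o l k≤N (≤-trans l≤ (m⊓n≤n k (N ∸ k)))

innerPoly-term : ∀ N k l →
  ((suc N C l) · qpow* l (qint (suc N ∸ 2 * l))) k ≡ (if k ≤ᵇ N then (suc N C l) * 𝟙 (l ≤ᵇ k ⊓ (N ∸ k)) else 0)
innerPoly-term N k l = trans (cong ((suc N C l) *_) (trans (if-if≡𝟙-∧ (l ≤ᵇ k) _) (cong 𝟙 (in-window N k l))))
                             (*-𝟙-∧ (suc N C l) (k ≤ᵇ N) _)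

innerPoly-window : ∀ N s k → innerPoly (suc N) s k ≡ (if k ≤ᵇ N then suc N C≤ (s ⊓ (k ⊓ (N ∸ k))) else 0)
innerPoly-window N zero    k = trans (innerPoly-term N k 0) (cong (if k ≤ᵇ N then_else 0) (+-identityʳ 1))
innerPoly-window N (suc s) k rewrite innerPoly-window N s k | innerPoly-term N k (suc s) with k ≤ᵇ N
... | false = refl
... | true  = C≤-⊓-suc (suc N) s (k ⊓ (N ∸ k))

innerPoly-low : ∀ N s k → k ≤ N / 2 → innerPoly (suc N) s k ≡ Σℕ≤ (k ⊓ s) (suc N C_)
innerPoly-low N s k k≤N/2 = begin
  innerPoly (suc N) s k                                       ≡⟨ innerPoly-window N s k ⟩
  (if k ≤ᵇ N then suc N C≤ (s ⊓ (k ⊓ (N ∸ k))) else 0)       ≡⟨ cong (λ c → if c then suc N C≤ (s ⊓ (k ⊓ (N ∸ k))) else 0)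
                                                                     (T⇒≡true (≤⇒≤ᵇ (≤-trans (m≤m+n k k) k+k≤N))) ⟩
  suc N C≤ (s ⊓ (k ⊓ (N ∸ k)))                                ≡⟨ cong (λ m → suc N C≤ (s ⊓ m)) (m≤n⇒m⊓n≡m (m+n≤o⇒m≤o∸n k k+k≤N)) ⟩
  suc N C≤ (s ⊓ k)                                            ≡⟨ cong (suc N C≤_) (⊓-comm s k) ⟩
  suc N C≤ (k ⊓ s)                                            ≡⟨ Σℕ≤≡C≤ (suc N) (k ⊓ s) ⟨
  Σℕ≤ (k ⊓ s) (suc N C_)                                      ∎
  where
  open ≡-Reasoning
  k+k≤N : k + k ≤ N
  k+k≤N = ≤-trans (≤-reflexive (trans (cong (k +_) (sym (+-identityʳ k))) (*-comm 2 k)))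
                  (≤-trans (*-monoˡ-≤ 2 k≤N/2) (m/n*n≤m N 2))

cutoff : ℕ → ℕ → ℕ → ℕ
cutoff a b k = (b ⊓ a) ⊓ (k ⊓ (a + b ∸ k))

cutoff-below : ∀ {a b k} → k ≤ b → cutoff a b k ≡ a ⊓ k
cutoff-below {a} {b} {k} k≤b = trans (⊓-interchange b a k (a + b ∸ k))
  (trans (cong₂ _⊓_ (m≥n⇒m⊓n≡n k≤b) (m≤n⇒m⊓n≡m a≤a+b∸k)) (⊓-comm k a))
  where
  a≤a+b∸k : a ≤ a + b ∸ k
  a≤a+b∸k = subst (_≤ a + b ∸ k) (m+n∸n≡m a b) (∸-monoʳ-≤ (a + b) k≤b)

cutoff-above : ∀ {a b k} → b ≤ k → cutoff a b k ≡ b ⊓ (a + b ∸ k)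
cutoff-above {a} {b} {k} b≤k = trans (⊓-interchange b a k (a + b ∸ k))
  (cong₂ _⊓_ (m≤n⇒m⊓n≡m b≤k) (m≥n⇒m⊓n≡n a+b∸k≤a))
  where
  a+b∸k≤a : a + b ∸ k ≤ a
  a+b∸k≤a = subst (a + b ∸ k ≤_) (m+n∸n≡m a b) (∸-monoʳ-≤ (a + b) b≤k)

C-suc-⊓ : ∀ a b → (suc a + suc b) C suc (a ⊓ b) ≡ (suc a + suc b) C suc b
C-suc-⊓ a b with ≤-total a b
... | inj₁ a≤b rewrite m≤n⇒m⊓n≡m a≤b =
  trans (nCk≡nC[n∸k] (m≤m+n (suc a) (suc b))) (cong ((suc a + suc b) C_) (m+n∸m≡n (suc a) (suc b)))
... | inj₂ b≤a rewrite m≥n⇒m⊓n≡n b≤a = refl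

rootedFormula : ℕ → ℕ → ℕ → ℕ
rootedFormula a b k = innerPoly (suc (a + b)) (b ⊓ a) k

rootedFormula-in : ∀ {a b k} → k ≤ a + b → rootedFormula a b k ≡ suc (a + b) C≤ cutoff a b k
rootedFormula-in {a} {b} {k} k≤a+b = trans (innerPoly-window (a + b) (b ⊓ a) k)
  (cong (λ c → if c then suc (a + b) C≤ cutoff a b k else 0) (T⇒≡true (≤⇒≤ᵇ k≤a+b)))

rootedFormula-out : ∀ {a b k} → a + b < k → rootedFormula a b k ≡ 0
rootedFormula-out {a} {b} {k} a+b<k = trans (innerPoly-window (a + b) (b ⊓ a) k)
  (cong (λ c → if c then suc (a + b) C≤ cutoff a b k else 0) (¬T⇒≡false (<⇒≱ a+b<k ∘ ≤ᵇ⇒≤ k (a + b))))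

rootedFormula-below : ∀ {a b k} → k ≤ b → rootedFormula a b k ≡ suc (a + b) C≤ (a ⊓ k)
rootedFormula-below {a} {b} {k} k≤b =
  trans (rootedFormula-in {a} {b} {k} (≤-trans k≤b (m≤n+m b a))) (cong (suc (a + b) C≤_) (cutoff-below {a} k≤b))

rootedFormula-above : ∀ {a b k} → b ≤ k → k ≤ a + b → rootedFormula a b k ≡ suc (a + b) C≤ (b ⊓ (a + b ∸ k))
rootedFormula-above {a} {b} {k} b≤k k≤a+b =
  trans (rootedFormula-in {a} {b} {k} k≤a+b) (cong (suc (a + b) C≤_) (cutoff-above {a} b≤k))

rootedFormula-step-below : ∀ a {b k} → k < b → rootedFormula a b k ≡ step before rootedFormula a b k
rootedFormula-step-below zero    {suc b} {k}     (s≤s k≤b) =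
  trans (rootedFormula-below {0} {suc b} {k} (m≤n⇒m≤1+n k≤b)) (sym (rootedFormula-below {0} {b} {k} k≤b))
rootedFormula-step-below (suc a) {suc b} {zero}  _ =
  trans (rootedFormula-below {suc a} {suc b} {0} z≤n) (sym (rootedFormula-below {suc a} {b} {0} z≤n))
rootedFormula-step-below (suc a) {suc b} {suc k} (s≤s k<b) = begin
  rootedFormula (suc a) (suc b) (suc k)              ≡⟨ rootedFormula-below {suc a} {suc b} {suc k} (m≤n⇒m≤1+n k<b) ⟩
  suc X C≤ suc (a ⊓ k)                              ≡⟨ C≤-pascal X (a ⊓ k) ⟩
  X C≤ suc (a ⊓ k) + X C≤ (a ⊓ k)                   ≡⟨ +-comm (X C≤ suc (a ⊓ k)) _ ⟩
  X C≤ (a ⊓ k) + X C≤ suc (a ⊓ k)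
    ≡⟨ cong₂ _+_ (rootedFormula-below {a} {suc b} {k} (m≤n⇒m≤1+n (≤-trans (n≤1+n k) k<b)))
                 (trans (rootedFormula-below {suc a} {b} {suc k} k<b) (cong (λ z → suc z C≤ suc (a ⊓ k)) (sym (+-suc a b)))) ⟨
  rootedFormula a (suc b) k + rootedFormula (suc a) b (suc k) ∎
  where
  open ≡-Reasoning
  X : ℕ
  X = suc a + suc b

rootedFormula-step-diagonal : ∀ a b → rootedFormula a b b ≡ (a + b) C b + step before rootedFormula a b b
rootedFormula-step-diagonal zero    zero    = refl
rootedFormula-step-diagonal zero    (suc b) = begin
  rootedFormula 0 (suc b) (suc b)                      ≡⟨ rootedFormula-below {0} {suc b} {suc b} ≤-refl ⟩
  1                                                   ≡⟨ cong₂ _+_ (nCn≡1 (suc b)) (rootedFormula-out {0} {b} ≤-refl) ⟨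
  (suc b) C (suc b) + rootedFormula 0 b (suc b)        ∎
  where open ≡-Reasoning
rootedFormula-step-diagonal (suc a) zero    = refl
rootedFormula-step-diagonal (suc a) (suc b) = begin
  rootedFormula (suc a) (suc b) (suc b)                ≡⟨ rootedFormula-below {suc a} {suc b} {suc b} ≤-refl ⟩
  suc X C≤ suc m                                      ≡⟨ C≤-pascal X m ⟩
  X C≤ m + X C suc m + X C≤ m                         ≡⟨ cong (λ z → X C≤ m + z + X C≤ m) (C-suc-⊓ a b) ⟩
  X C≤ m + X C suc b + X C≤ m                         ≡⟨ p+c+q≡c+[p+q] (X C≤ m) (X C suc b) (X C≤ m) ⟩
  X C suc b + (X C≤ m + X C≤ m)                       ≡⟨ cong (X C suc b +_) (cong₂ _+_ low high) ⟨
  X C suc b + (rootedFormula a (suc b) b + rootedFormula (suc a) b (suc b)) ∎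
  where
  open ≡-Reasoning
  X m : ℕ
  X = suc a + suc b
  m = a ⊓ b
  low : rootedFormula a (suc b) b ≡ X C≤ m
  low = rootedFormula-below {a} {suc b} {b} (n≤1+n b)
  high : rootedFormula (suc a) b (suc b) ≡ X C≤ m
  high = begin
    rootedFormula (suc a) b (suc b)                    ≡⟨ rootedFormula-above {suc a} {b} {suc b} (n≤1+n b) (s≤s (m≤n+m b a)) ⟩
    suc (suc a + b) C≤ (b ⊓ (a + b ∸ b))              ≡⟨ cong₂ _C≤_ (cong suc (+-suc a b)) (sym (trans (cong (b ⊓_) (m+n∸n≡m a b)) (⊓-comm b a))) ⟨
    X C≤ m                                            ∎

rootedFormula-step-outside : ∀ a b k → a + b < k → rootedFormula a b k ≡ step before rootedFormula a b k
rootedFormula-step-outside zero    zero    k       0<k = rootedFormula-out {0} {0} {k} 0<k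
rootedFormula-step-outside zero    (suc b) k       b<k =
  trans (rootedFormula-out {0} {suc b} {k} b<k) (sym (rootedFormula-out {0} {b} {k} (<-trans (n<1+n b) b<k)))
rootedFormula-step-outside (suc a) zero    (suc k) a<k =
  trans (rootedFormula-out {suc a} {0} a<k) (sym (trans (+-identityʳ _) (rootedFormula-out {a} {0} {k} (≤-pred a<k))))
rootedFormula-step-outside (suc a) (suc b) (suc k) a+b<k =
  trans (rootedFormula-out {suc a} {suc b} a+b<k)
        (sym (cong₂ _+_ (rootedFormula-out {a} {suc b} {k} (≤-pred a+b<k))
                        (rootedFormula-out {suc a} {b} {suc k} (<-trans (s≤s (≤-reflexive (sym (+-suc a b)))) a+b<k))))

rootedFormula-peel : ∀ a b k → b < suc k →
  suc (suc (a + b)) C≤ (b ⊓ (a + b ∸ k)) ≡ suc (a + b) C≤ (b ⊓ (a + b ∸ k)) + highStep 0 rootedFormula (suc a) b (suc k)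
rootedFormula-peel a zero    k _ = refl
rootedFormula-peel a (suc b) k b<k with k ≤? a + b
... | yes k≤a+b = begin
  suc Y C≤ (suc b ⊓ (a + suc b ∸ k))               ≡⟨ cong (λ z → suc Y C≤ (suc b ⊓ z)) a+1+b∸k ⟩
  suc Y C≤ suc m                                    ≡⟨ C≤-pascal Y m ⟩
  Y C≤ suc m + Y C≤ m                               ≡⟨ cong₂ _+_ (cong (λ z → Y C≤ (suc b ⊓ z)) a+1+b∸k)
                                                                 (trans (rootedFormula-above {suc a} {b} {suc k} b≤1+k (s≤s k≤a+b))
                                                                        (cong (λ z → suc z C≤ m) (sym (+-suc a b)))) ⟨
  Y C≤ (suc b ⊓ (a + suc b ∸ k)) + rootedFormula (suc a) b (suc k) ∎
  where
  open ≡-Reasoning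
  Y m : ℕ
  Y = suc (a + suc b)
  m = b ⊓ (a + b ∸ k)
  a+1+b∸k : a + suc b ∸ k ≡ suc (a + b ∸ k)
  a+1+b∸k = trans (cong (_∸ k) (+-suc a b)) (+-∸-assoc 1 k≤a+b)
  b≤1+k : b ≤ suc k
  b≤1+k = ≤-trans (n≤1+n b) (≤-trans (≤-pred b<k) (n≤1+n k))
... | no k≰a+b = begin
  suc Y C≤ (suc b ⊓ (a + suc b ∸ k))               ≡⟨ cong (λ z → suc Y C≤ (suc b ⊓ z)) a+1+b∸k≡0 ⟩
  1                                                 ≡⟨ cong₂ _+_ (cong (λ z → Y C≤ (suc b ⊓ z)) a+1+b∸k≡0)
                                                                 (rootedFormula-out {suc a} {b} {suc k} (s≤s (≰⇒> k≰a+b))) ⟨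
  Y C≤ (suc b ⊓ (a + suc b ∸ k)) + rootedFormula (suc a) b (suc k) ∎
  where
  open ≡-Reasoning
  Y : ℕ
  Y = suc (a + suc b)
  a+1+b∸k≡0 : a + suc b ∸ k ≡ 0
  a+1+b∸k≡0 = m≤n⇒m∸n≡0 (subst (_≤ k) (sym (+-suc a b)) (≰⇒> k≰a+b))

rootedFormula-step-inside : ∀ a b k → b < k → k ≤ a + b → rootedFormula a b k ≡ step before rootedFormula a b k
rootedFormula-step-inside zero    b k       b<k k≤b = contradiction k≤b (<⇒≱ b<k)
rootedFormula-step-inside (suc a) b (suc k) b<k k≤a+b = begin
  rootedFormula (suc a) b (suc k)
    ≡⟨ rootedFormula-above {suc a} {b} {suc k} (<⇒≤ b<k) k≤a+b ⟩
  suc (suc (a + b)) C≤ (b ⊓ (a + b ∸ k))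
    ≡⟨ rootedFormula-peel a b k b<k ⟩
  suc (a + b) C≤ (b ⊓ (a + b ∸ k)) + highStep 0 rootedFormula (suc a) b (suc k)
    ≡⟨ cong (_+ highStep 0 rootedFormula (suc a) b (suc k)) (rootedFormula-above {a} {b} {k} (≤-pred b<k) (≤-pred k≤a+b)) ⟨
  rootedFormula a b k + highStep 0 rootedFormula (suc a) b (suc k) ∎
  where open ≡-Reasoning

rootedFormula-step : ∀ a b k → rootedFormula a b k ≡ 𝟙 (k ≡ᵇ b) * ((a + b) C b) + step before rootedFormula a b k
rootedFormula-step a b k with k ≡ᵇ b | ≡ᵇ-reflects-≡ k b
... | true  | ofʸ refl = trans (rootedFormula-step-diagonal a k)
                               (cong (_+ step before rootedFormula a k k) (sym (*-identityˡ ((a + k) C k))))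
... | false | ofⁿ k≢b with <-cmp k b
...   | tri< k<b _ _ = rootedFormula-step-below a k<b
...   | tri≈ _ k≡b _ = contradiction k≡b k≢b
...   | tri> _ _ b<k with k ≤? a + b
...     | yes k≤a+b = rootedFormula-step-inside a b k b<k k≤a+b
...     | no  k≰a+b = rootedFormula-step-outside a b k (≰⇒> k≰a+b)

-- Summing over the position of the root

rootedPatterns : ℕ → ℕ → ℕ → ℕ → ℕ
rootedPatterns n a b k = ∑ {n} λ r → patterns n (sides r) a b k

∑-lowStep : ∀ {n} d (F : Fin n → ℕ → ℕ → ℕ → ℕ) a b k →
  ∑ (λ r → lowStep d (F r) a b k) ≡ lowStep d (λ a b k → ∑ λ r → F r a b k) a b k
∑-lowStep {n} d F zero    b k = ∑-replicate-zero n
∑-lowStep     d F (suc a) b k = ∑-if (d ≤ᵇ k) (λ r → F r a b (k ∸ d))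

∑-highStep : ∀ {n} d (F : Fin n → ℕ → ℕ → ℕ → ℕ) a b k →
  ∑ (λ r → highStep d (F r) a b k) ≡ highStep d (λ a b k → ∑ λ r → F r a b k) a b k
∑-highStep {n} d F a zero    k = ∑-replicate-zero n
∑-highStep     d F a (suc b) k = ∑-if (d ≤ᵇ k) (λ r → F r a b (k ∸ d))

rootedPatterns-suc : ∀ n a b k →
  rootedPatterns (suc n) a b k ≡ patterns n (λ _ → after) a b k + step before (rootedPatterns n) a b k
rootedPatterns-suc n a b k = cong (patterns n (λ _ → after) a b k +_)
  (trans (∑-distrib-+ (λ r → lowStep 1 (patterns n (sides r)) a b k) (λ r → highStep 0 (patterns n (sides r)) a b k))
         (cong₂ _+_ (∑-lowStep 1 (λ r → patterns n (sides r)) a b k) (∑-highStep 0 (λ r → patterns n (sides r)) a b k)))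

patterns-after : ∀ n a b k → a + b ≡ n → patterns n (λ _ → after) a b k ≡ 𝟙 (k ≡ᵇ b) * (n C b)
patterns-after zero    zero    zero    zero    _ = refl
patterns-after zero    zero    zero    (suc k) _ = refl
patterns-after (suc n) (suc a) zero    k       e = trans (+-identityʳ _) (patterns-after n a zero k (suc-injective e))
patterns-after (suc n) zero    (suc b) zero    e = refl
patterns-after (suc n) zero    (suc b) (suc k) e = begin
  patterns n (λ _ → after) 0 b k     ≡⟨ patterns-after n 0 b k b≡n ⟩
  𝟙 (k ≡ᵇ b) * (n C b)               ≡⟨ cong (𝟙 (k ≡ᵇ b) *_) (trans (cong (n C_) b≡n) (trans (nCn≡1 n) (sym (nCn≡1 (suc n))))) ⟩
  𝟙 (k ≡ᵇ b) * (suc n C suc n)       ≡⟨ cong (λ m → 𝟙 (k ≡ᵇ b) * (suc n C suc m)) b≡n ⟨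
  𝟙 (k ≡ᵇ b) * (suc n C suc b)       ∎
  where
  open ≡-Reasoning
  b≡n : b ≡ n
  b≡n = suc-injective e
patterns-after (suc n) (suc a) (suc b) zero    e = trans (+-identityʳ _) (patterns-after n a (suc b) 0 (suc-injective e))
patterns-after (suc n) (suc a) (suc b) (suc k) e = begin
  patterns n (λ _ → after) a (suc b) (suc k) + patterns n (λ _ → after) (suc a) b k
    ≡⟨ cong₂ _+_ (patterns-after n a (suc b) (suc k) (suc-injective e))
                 (patterns-after n (suc a) b k (trans (sym (+-suc a b)) (suc-injective e))) ⟩
  𝟙 (k ≡ᵇ b) * (n C suc b) + 𝟙 (k ≡ᵇ b) * (n C b)
    ≡⟨ *-distribˡ-+ (𝟙 (k ≡ᵇ b)) (n C suc b) (n C b) ⟨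
  𝟙 (k ≡ᵇ b) * (n C suc b + n C b)
    ≡⟨ cong (𝟙 (k ≡ᵇ b) *_) (trans (+-comm (n C suc b) (n C b)) (nCk+nC[k+1]≡[n+1]C[k+1] n b)) ⟩
  𝟙 (k ≡ᵇ b) * (suc n C suc b) ∎
  where open ≡-Reasoning

mutual
  rootedPatterns≡rootedFormula : ∀ n a b k → a + b ≡ n → rootedPatterns (suc n) a b k ≡ rootedFormula a b k
  rootedPatterns≡rootedFormula n a b k a+b≡n = begin
    rootedPatterns (suc n) a b k
      ≡⟨ rootedPatterns-suc n a b k ⟩
    patterns n (λ _ → after) a b k + step before (rootedPatterns n) a b k
      ≡⟨ cong₂ _+_ (patterns-after n a b k a+b≡n)
                   (cong₂ _+_ (lowStep-rootedPatterns n a b k a+b≡n) (highStep-rootedPatterns n a b k a+b≡n)) ⟩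
    𝟙 (k ≡ᵇ b) * (n C b) + step before rootedFormula a b k
      ≡⟨ cong (λ m → 𝟙 (k ≡ᵇ b) * (m C b) + step before rootedFormula a b k) a+b≡n ⟨
    𝟙 (k ≡ᵇ b) * ((a + b) C b) + step before rootedFormula a b k
      ≡⟨ rootedFormula-step a b k ⟨
    rootedFormula a b k ∎
    where open ≡-Reasoning

  lowStep-rootedPatterns : ∀ n a b k → a + b ≡ n → lowStep 1 (rootedPatterns n) a b k ≡ lowStep 1 rootedFormula a b k
  lowStep-rootedPatterns n       zero    b k       _ = refl
  lowStep-rootedPatterns n       (suc a) b zero    _ = refl
  lowStep-rootedPatterns (suc n) (suc a) b (suc k) e = rootedPatterns≡rootedFormula n a b k (suc-injective e)

  highStep-rootedPatterns : ∀ n a b k → a + b ≡ n → highStep 0 (rootedPatterns n) a b k ≡ highStep 0 rootedFormula a b k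
  highStep-rootedPatterns n       a zero    k _ = refl
  highStep-rootedPatterns zero    a (suc b) k e = contradiction (trans (sym (+-suc a b)) e) λ ()
  highStep-rootedPatterns (suc n) a (suc b) k e = rootedPatterns≡rootedFormula n a b k (suc-injective (trans (sym (+-suc a b)) e))

module AtIndex (n : ℕ) (α : List ℕ) (i : Fin (length α)) where
  open RootColour i

  t : Content (length α)
  t = lookup α

  L H : ℕ
  L = size low t
  H = size high t

  bαi-factorised : ∀ k →
    bαi n α i k ≡ 𝟙 (t i ≡ᵇ 1) * (arr low t * (arr high t * rootedPatterns n L H k))
  bαi-factorised k = begin
    bαi n α i k
      ≡⟨ count-as-∑ n (length α) (λ r κ → isProper r κ ∧ hasType α κ ∧ (vlookup κ r ≡ᶠ i) ∧ (asc r κ ≡ᵇ k)) ⟩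
    ∑ {n} (λ r → ∑κ n λ κ → 𝟙 (isProper r κ ∧ hasType α κ ∧ (vlookup κ r ≡ᶠ i) ∧ (asc r κ ≡ᵇ k)))
      ≡⟨ sum-cong-≗ (λ r → ∑κ-cong n λ κ → cong 𝟙 (trans (proper∧rootColour≡fitsAll r κ (hasType α κ) k)
                                    (cong (λ b → fitsAll (sides r) κ ∧ b ∧ (ascents (sides r) κ ≡ᵇ k)) (hasType≡hasContent α κ)))) ⟩
    ∑ {n} (λ r → fittingColourings (sides r) t k)
      ≡⟨ sum-cong-≗ (λ r → trans (fittingColourings≡factorisedCount (sides r) t k)
                                 (cong (λ R → 𝟙 (t i ≡ᵇ R) * (arr low t * (arr high t * patterns n (sides r) L H k)))
                                       (#roots-sides r))) ⟩
    ∑ {n} (λ r → 𝟙 (t i ≡ᵇ 1) * (arr low t * (arr high t * patterns n (sides r) L H k)))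
      ≡⟨ *-distribˡ-∑³ (𝟙 (t i ≡ᵇ 1)) (arr low t) (arr high t) (λ r → patterns n (sides r) L H k) ⟨
    𝟙 (t i ≡ᵇ 1) * (arr low t * (arr high t * rootedPatterns n L H k)) ∎
    where open ≡-Reasoning

  size-low : L ≡ Lα α i
  size-low = size-take α (toℕ i)

  size-high : H ≡ Rα α i
  size-high = size-drop α (toℕ i)

  arr-low : arr low t ≡ mult (lcomp α i)
  arr-low = arr≡mult low t (lcomp α i) size-low (∏!-take α (toℕ i))

  arr-high : arr high t ≡ mult (rcomp α i)
  arr-high = arr≡mult high t (rcomp α i) size-high (∏!-drop α (toℕ i))

  module _ (sum≡n : sum α ≡ n) (tᵢ≡1 : t i ≡ 1) where

    n≡1+L+H : n ≡ suc (L + H)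
    n≡1+L+H = begin
      n                                   ≡⟨ sum≡n ⟨
      sum α                               ≡⟨ sum-around α i ⟩
      Lα α i + (t i + Rα α i)             ≡⟨ cong₂ _+_ (sym size-low) (cong₂ _+_ tᵢ≡1 (sym size-high)) ⟩
      L + suc H                           ≡⟨ +-suc L H ⟩
      suc (L + H)                         ∎
      where open ≡-Reasoning

    rootedPatterns≡innerPoly : ∀ k → rootedPatterns n L H k ≡ innerPoly n (sα α i) k
    rootedPatterns≡innerPoly k =
      trans (cong (λ m → rootedPatterns m L H k) n≡1+L+H)
      (trans (rootedPatterns≡rootedFormula (L + H) L H k refl)
             (cong₂ (λ m s → innerPoly m s k) (sym n≡1+L+H) (cong₂ _⊓_ size-high size-low)))

    bαi≡mult*innerPoly : ∀ k → bαi n α i k ≡ mult (rcomp α i) * mult (lcomp α i) * innerPoly n (sα α i) k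
    bαi≡mult*innerPoly k = begin
      bαi n α i k
        ≡⟨ bαi-factorised k ⟩
      𝟙 (t i ≡ᵇ 1) * (arr low t * (arr high t * rootedPatterns n L H k))
        ≡⟨ cong (λ x → 𝟙 (x ≡ᵇ 1) * (arr low t * (arr high t * rootedPatterns n L H k))) tᵢ≡1 ⟩
      1 * (arr low t * (arr high t * rootedPatterns n L H k))
        ≡⟨ *-identityˡ _ ⟩
      arr low t * (arr high t * rootedPatterns n L H k)
        ≡⟨ cong₂ _*_ arr-low (cong₂ _*_ arr-high (rootedPatterns≡innerPoly k)) ⟩
      mult (lcomp α i) * (mult (rcomp α i) * innerPoly n (sα α i) k)
        ≡⟨ m*[n*o]≡n*[m*o] (mult (lcomp α i)) (mult (rcomp α i)) (innerPoly n (sα α i) k) ⟩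
      mult (rcomp α i) * (mult (lcomp α i) * innerPoly n (sα α i) k)
        ≡⟨ *-assoc (mult (rcomp α i)) (mult (lcomp α i)) (innerPoly n (sα α i) k) ⟨
      mult (rcomp α i) * mult (lcomp α i) * innerPoly n (sα α i) k ∎
      where open ≡-Reasoning

    bαi-lowDegree : ∀ k → k ≤ (n ∸ 1) / 2 →
      bαi n α i k ≡ mult (rcomp α i) * mult (lcomp α i) * Σℕ≤ (k ⊓ sα α i) (λ l → n C l)
    bαi-lowDegree k k≤ = trans (bαi≡mult*innerPoly k) (cong (mult (rcomp α i) * mult (lcomp α i) *_) (begin
      innerPoly n (sα α i) k                     ≡⟨ cong (λ m → innerPoly m (sα α i) k) n≡1+L+H ⟩
      innerPoly (suc N) (sα α i) k               ≡⟨ innerPoly-low N (sα α i) k (subst (λ m → k ≤ (m ∸ 1) / 2) n≡1+L+H k≤) ⟩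
      Σℕ≤ (k ⊓ sα α i) (suc N C_)                ≡⟨ cong (λ m → Σℕ≤ (k ⊓ sα α i) (m C_)) n≡1+L+H ⟨
      Σℕ≤ (k ⊓ sα α i) (n C_)                    ∎))
      where
      open ≡-Reasoning
      N : ℕ
      N = L + H

  bαi≡term : sum α ≡ n → ∀ k → bαi n α i k ≡ 𝟙 (t i ≡ᵇ 1) * termᵢ n α i k
  bαi≡term sum≡n k with t i ≡ᵇ 1 in tᵢ≡ᵇ1 | ≡ᵇ-reflects-≡ (t i) 1
  ... | false | _        = trans (bαi-factorised k)
    (cong (λ b → 𝟙 b * (arr low t * (arr high t * rootedPatterns n L H k))) tᵢ≡ᵇ1)
  ... | true  | ofʸ tᵢ≡1 = trans (bαi≡mult*innerPoly sum≡n tᵢ≡1 k) (sym (+-identityʳ _))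

bα≡∑bαi : ∀ n α k → bα n α k ≡ ∑ (λ i → bαi n α i k)
bα≡∑bαi n α k = begin
  bα n α k
    ≡⟨ count-as-∑ n ℓ (λ r κ → isProper r κ ∧ hasType α κ ∧ (asc r κ ≡ᵇ k)) ⟩
  ∑ {n} (λ r → ∑κ n λ κ → 𝟙 (isProper r κ ∧ hasType α κ ∧ (asc r κ ≡ᵇ k)))
    ≡⟨ sum-cong-≗ (λ r → ∑κ-cong n (split r)) ⟩
  ∑ {n} (λ r → ∑κ n λ κ → ∑ {ℓ} λ i → 𝟙 (with-root-colour r κ i))
    ≡⟨ sum-cong-≗ (λ r → ∑κ-comm n (λ κ i → 𝟙 (with-root-colour r κ i))) ⟩
  ∑ {n} (λ r → ∑ {ℓ} λ i → ∑κ n λ κ → 𝟙 (with-root-colour r κ i))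
    ≡⟨ ∑-comm (λ r i → ∑κ n λ κ → 𝟙 (with-root-colour r κ i)) ⟩
  ∑ {ℓ} (λ i → ∑ {n} λ r → ∑κ n λ κ → 𝟙 (with-root-colour r κ i))
    ≡⟨ sum-cong-≗ (λ i → count-as-∑ n ℓ (λ r κ → with-root-colour r κ i)) ⟨
  ∑ (λ i → bαi n α i k) ∎
  where
  open ≡-Reasoning
  ℓ : ℕ
  ℓ = length α
  with-root-colour : Fin n → Colouring n ℓ → Fin ℓ → Bool
  with-root-colour r κ i = isProper r κ ∧ hasType α κ ∧ (vlookup κ r ≡ᶠ i) ∧ (asc r κ ≡ᵇ k)
  split : ∀ r κ → 𝟙 (isProper r κ ∧ hasType α κ ∧ (asc r κ ≡ᵇ k)) ≡ ∑ λ i → 𝟙 (with-root-colour r κ i)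
  split r κ = sym (trans
    (sum-cong-≗ λ i → trans (𝟙-∧-third (isProper r κ) (hasType α κ) (vlookup κ r ≡ᶠ i) (asc r κ ≡ᵇ k))
                            (cong (λ b → 𝟙 b * 𝟙 without-i) (≡ᶠ-sym (vlookup κ r) i)))
    (∑-𝟙-pick (vlookup κ r) (λ _ → 𝟙 without-i)))
    where
    without-i : Bool
    without-i = isProper r κ ∧ hasType α κ ∧ (asc r κ ≡ᵇ k)

rhsPoly≡∑ : ∀ n α k → rhsPoly n α k ≡ ∑ (λ i → 𝟙 (lookup α i ≡ᵇ 1) * termᵢ n α i k)
rhsPoly≡∑ n α k = trans (Σₚ-filterᵇ _ (allFin (length α)) (termᵢ n α) k) (sum-map-allFin (length α) _)

theorem4p9 : (n : ℕ) → 2 ≤ n → (α : List ℕ) → IsComposition n α →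
    ((k : ℕ) → bα n α k ≡ rhsPoly n α k)
    × ((i : Fin (length α)) → lookup α i ≡ 1 → (k : ℕ) → k ≤ (n ∸ 1) / 2 →
        bαi n α i k
          ≡ mult (rcomp α i) * mult (lcomp α i) * Σℕ≤ (k ⊓ sα α i) (λ l → n C l))
theorem4p9 n _ α (_ , sum≡n) = coefficients , lowDegree
  where
  coefficients : ∀ k → bα n α k ≡ rhsPoly n α k
  coefficients k = begin
    bα n α k                                              ≡⟨ bα≡∑bαi n α k ⟩
    ∑ (λ i → bαi n α i k)                                 ≡⟨ sum-cong-≗ (λ i → AtIndex.bαi≡term n α i sum≡n k) ⟩
    ∑ (λ i → 𝟙 (lookup α i ≡ᵇ 1) * termᵢ n α i k)         ≡⟨ rhsPoly≡∑ n α k ⟨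
    rhsPoly n α k                                         ∎
    where open ≡-Reasoning
  lowDegree : ∀ i → lookup α i ≡ 1 → ∀ k → k ≤ (n ∸ 1) / 2 →
    bαi n α i k ≡ mult (rcomp α i) * mult (lcomp α i) * Σℕ≤ (k ⊓ sα α i) (λ l → n C l)
  lowDegree i αᵢ≡1 = AtIndex.bαi-lowDegree n α i sum≡n αᵢ≡1
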